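{- Let $\beta>1$ be a quadratic Pisot unit, i.e. the root $>1$ of $x^2-ax-1$ with $a$ a positive integer, and let $\alpha=-\beta^{ -1}$. If a number $z$ has an eventually periodic $\alpha$-adic expansion, then all $\alpha$-adic expansions of $z$ are eventually periodic.
   Context: Here $\mathrm{d}_\beta(1)=a1$. An $\alpha$-adic expansion of a number $z$ is a sequence of digits $(x_i)_{i\ge-k}$ (some $k\in\mathbb{Z}$) in $\{0,1,\dots,a\}$, written $\cdots x_1x_0\bullet x_{ -1}\cdots x_{ -k}$, with $z=\sum_{i\ge-k}x_i\alpha^i$, which is weakly admissible: every factor $x_jx_{j-1}$ (read left to right) is lexicographically strictly smaller than $a1$. It is eventually periodic if there is $p\ge1$ with $x_{i+p}=x_i$ for all sufficiently large $i$ (finite expansions, with zeros to the left, count as eventually periodic). -}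

module Defs where

open import Data.Nat as ℕ using (ℕ; zero; suc)
open import Data.Integer as ℤ using (ℤ; +_; 0ℤ; 1ℤ)
open import Data.Product using (Σ; ∃; _×_; _,_)
open import Data.Sum using (_⊎_)
open import Relation.Binary.PropositionalEquality using (_≡_)

-- Throughout, a : ℕ with 1 ≤ a, β > 1 is the root of x² - a x - 1,
-- α = -β⁻¹ = a - β (the conjugate of β), Δ = a² + 4, β = (a + √Δ)/2.

-- Elements of ℤ[β] = ℤ[α, α⁻¹]:  (m , n)  represents  m + n β.
ℤβ : Set
ℤβ = ℤ × ℤ

_⊕_ : ℤβ → ℤβ → ℤβ
(m , n) ⊕ (p , q) = (m ℤ.+ p , n ℤ.+ q)

_⊖_ : ℤβ → ℤβ → ℤβ
(m , n) ⊖ (p , q) = (m ℤ.- p , n ℤ.- q)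

-- multiplication in ℤ[β] using β² = a β + 1
mulβ : ℕ → ℤβ → ℤβ → ℤβ
mulβ a (m , n) (p , q) =
  (m ℤ.* p ℤ.+ n ℤ.* q , m ℤ.* q ℤ.+ n ℤ.* p ℤ.+ (+ a) ℤ.* n ℤ.* q)

ι : ℤ → ℤβ
ι m = (m , 0ℤ)

-- α = -β⁻¹ = a - β
αβ : ℕ → ℤβ
αβ a = (+ a , ℤ.- 1ℤ)

-- α⁻¹ = -β
α⁻¹β : ℕ → ℤβ
α⁻¹β a = (0ℤ , ℤ.- 1ℤ)

powβ : ℕ → ℤβ → ℕ → ℤβ
powβ a x zero    = ι 1ℤ
powβ a x (suc n) = mulβ a x (powβ a x n)

-- Exact real comparison on ℚ(√Δ) for integer data.
-- LtSqrt a c q r  means the real inequality  c + q √Δ < r  (Δ = a² + 4).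

Δ : ℕ → ℤ
Δ a = + (a ℕ.* a ℕ.+ 4)

LtSqrt : ℕ → ℤ → ℤ → ℤ → Set
LtSqrt a c q r =
  (0ℤ ℤ.≤ q → (0ℤ ℤ.< s) × (q ℤ.* q ℤ.* Δ a ℤ.< s ℤ.* s))
  × (q ℤ.< 0ℤ → (0ℤ ℤ.≤ s) ⊎ (s ℤ.* s ℤ.< q ℤ.* q ℤ.* Δ a))
  where s = r ℤ.- c

-- AbsLt1 a (p , q) : the real inequality | p + q β | < 1.
-- Since 2(p + q β) = (2p + q a) + q √Δ, this is
--   (2p + qa) + q√Δ < 2   and   -(2p + qa) + (-q)√Δ < 2.
AbsLt1 : ℕ → ℤβ → Set
AbsLt1 a (p , q) =
  LtSqrt a c q (+ 2) × LtSqrt a (ℤ.- c) (ℤ.- q) (+ 2)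
  where c = (+ 2) ℤ.* p ℤ.+ q ℤ.* (+ a)

-- Small a N x : the real inequality |x| < 1/(N+1)
Small : ℕ → ℕ → ℤβ → Set
Small a N (p , q) = AbsLt1 a ((+ suc N) ℤ.* p , (+ suc N) ℤ.* q)

-- α-adic expansions  ⋯ x₁ x₀ • x₋₁ ⋯ x₋ₖ  with k = shift, and
-- x_(j - k) = digit j  (j : ℕ). Digits lie in {0,…,a}.

record Expansion (a : ℕ) : Set where
  field
    shift       : ℕ
    digit       : ℕ → ℕ
    digit-bound : ∀ j → digit j ℕ.≤ a
open Expansion public

-- every factor x_j x_{j-1} is lexicographically strictly smaller than a1
WeaklyAdmissible : ∀ {a} → Expansion a → Set
WeaklyAdmissible {a} x =
  ∀ j → (digit x (suc j) ℕ.< a)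
        ⊎ ((digit x (suc j) ≡ a) × (digit x j ℕ.< 1))

EventuallyPeriodic : ∀ {a} → Expansion a → Set
EventuallyPeriodic x =
  Σ ℕ λ p → (1 ℕ.≤ p) × Σ ℕ λ N →
    ∀ i → N ℕ.≤ i → digit x (i ℕ.+ p) ≡ digit x i

-- partial sum  Σ_{j<n} x_(j-k) α^(j-k)  as an exact element of ℤ[β]
partialSum : ∀ {a} → Expansion a → ℕ → ℤβ
partialSum {a} x zero    = ι 0ℤ
partialSum {a} x (suc n) =
  partialSum x n ⊕
  mulβ a (ι (+ digit x n))
         (mulβ a (powβ a (αβ a) n) (powβ a (α⁻¹β a) (shift x)))

-- the two (convergent) series Σ x_i α^i and Σ y_i α^i have the same
-- real value: the difference of partial sums tends to 0.
SameValue : ∀ {a} → Expansion a → Expansion a → Set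
SameValue {a} x y =
  ∀ N → Σ ℕ λ M → ∀ n → M ℕ.≤ n →
    Small a N (partialSum x n ⊖ partialSum y n)

-- Write both expansions with the common shift K and digit sequences X, Y, and let the
-- carry T n = Σ_{j<n} (X j - Y j) α^(j - n), so that T (n + 1) = -β (T n + X n - Y n) and the
-- difference of the n-th partial sums is α^(n - K) (T n + O(1)).  Once |T n| ≥ 2β the carry
-- grows like β^n, which is incompatible with equal values.  Below that threshold T only takes
-- the values 0, ±β, ±(1 + β), and weak admissibility leaves one move out of each nonzero
-- value: the carry either stays 0 (and then X n = Y n) or, within two steps, enters the cycle
-- 1 + β ↔ -(1 + β), on which Y is 2-periodic and X alternates between 0 and a.  If X is
-- periodic from N on and T N = 0, the cycle can never be entered, as X would then alternate
-- from N on, contradicting the digits read when leaving 0; so Y eventually equals X or is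
-- 2-periodic.  Comparisons with 0 in ℤ[β] are decided in ℤ[√Δ], Δ = a² + 4, which needs √Δ ∉ ℚ.
module Submission where

open import Data.Nat as Nat using (ℕ; zero; suc; z≤n; s≤s)
import Data.Nat.Properties as ℕP
open import Data.Nat.Induction using (<-rec)
open import Data.Integer as Int using (ℤ; +_; 0ℤ; 1ℤ)
import Data.Integer.Properties as ℤP
import Data.Integer.Tactic.RingSolver as ℤSolver
import Data.Nat.Tactic.RingSolver as ℕSolver
open import Data.Product using (Σ; _×_; _,_; proj₁; proj₂)
open import Data.Product.Properties using (≡-dec)
open import Data.Sum using (_⊎_; inj₁; inj₂; [_,_]′)
open import Function using (id)
open import Relation.Binary.Definitions using (tri<; tri≈; tri>)
open import Data.Empty using (⊥; ⊥-elim)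
open import Relation.Binary.PropositionalEquality
open import Relation.Nullary using (¬_; yes; no)

open import Level using (0ℓ)
open import Data.Maybe using (Maybe; just; nothing)
open import Algebra.Bundles using (CommutativeRing)
open import Algebra.Structures using (IsCommutativeRing)
open import Tactic.RingSolver using (solve-∀)
import Tactic.RingSolver.Core.AlmostCommutativeRing as ACR

open import Defs

module _ where

  open Nat using (_+_; _*_; _≤_)

  EventuallyPeriodicSeq : (ℕ → ℕ) → Set
  EventuallyPeriodicSeq f = Σ ℕ λ p → (1 ≤ p) × Σ ℕ λ N → ∀ i → N ≤ i → f (i + p) ≡ f i

  periodic-iterate : ∀ {f : ℕ → ℕ} {N p} → (∀ i → N ≤ i → f (i + p) ≡ f i) →
                     ∀ k i → N ≤ i → f (i + k * p) ≡ f i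
  periodic-iterate {f} per zero    i N≤i = cong f (ℕP.+-identityʳ i)
  periodic-iterate {f} {N} {p} per (suc k) i N≤i = begin
    f (i + (p + k * p)) ≡⟨ cong f (reorder i p (k * p)) ⟩
    f (i + k * p + p)   ≡⟨ per (i + k * p) (ℕP.≤-trans N≤i (ℕP.m≤m+n i (k * p))) ⟩
    f (i + k * p)       ≡⟨ periodic-iterate per k i N≤i ⟩
    f i                 ∎
    where
    open ≡-Reasoning
    reorder : ∀ i p q → i + (p + q) ≡ i + q + p
    reorder = ℕSolver.solve-∀

  consecutive-pull-back : ∀ {f : ℕ → ℕ} {N p K} (P : ℕ → ℕ → Set) → 1 ≤ p →
                          (∀ i → N ≤ i → f (i + p) ≡ f i) →
                          (∀ j → K ≤ j → P (f j) (f (suc j))) → ∀ j → N ≤ j → P (f j) (f (suc j))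
  consecutive-pull-back {f} {N} {p} {K} P 1≤p per from-K j N≤j =
    subst₂ P (periodic-iterate per K j N≤j) (periodic-iterate per K (suc j) (ℕP.m≤n⇒m≤1+n N≤j))
      (from-K (j + K * p) (ℕP.≤-trans K≤K*p (ℕP.m≤n+m (K * p) j)))
    where
    K≤K*p : K ≤ K * p
    K≤K*p = subst (_≤ K * p) (ℕP.*-identityʳ K) (ℕP.*-monoʳ-≤ K 1≤p)

  pad : ℕ → (ℕ → ℕ) → ℕ → ℕ
  pad zero    f j       = f j
  pad (suc δ) f zero    = 0
  pad (suc δ) f (suc j) = pad δ f j

  pad-shift : ∀ δ f n → pad δ f (δ + n) ≡ f n
  pad-shift zero    f n = refl
  pad-shift (suc δ) f n = pad-shift δ f n

  pad-periodic : ∀ δ f → EventuallyPeriodicSeq f → EventuallyPeriodicSeq (pad δ f)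
  pad-periodic δ f (p , 1≤p , N , per) = p , 1≤p , δ + N , periodic
    where
    periodic : ∀ i → δ + N ≤ i → pad δ f (i + p) ≡ pad δ f i
    periodic i δ+N≤i with ℕP.m≤n⇒∃[o]m+o≡n δ+N≤i
    ... | k , refl = begin
      pad δ f (δ + N + k + p)     ≡⟨ cong (pad δ f) (trans (ℕP.+-assoc (δ + N) k p) (ℕP.+-assoc δ N (k + p))) ⟩
      pad δ f (δ + (N + (k + p))) ≡⟨ pad-shift δ f (N + (k + p)) ⟩
      f (N + (k + p))             ≡⟨ cong f (sym (ℕP.+-assoc N k p)) ⟩
      f (N + k + p)               ≡⟨ per (N + k) (ℕP.m≤m+n N k) ⟩
      f (N + k)                   ≡⟨ sym (pad-shift δ f (N + k)) ⟩
      pad δ f (δ + (N + k))       ≡⟨ cong (pad δ f) (sym (ℕP.+-assoc δ N k)) ⟩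
      pad δ f (δ + N + k)         ∎
      where open ≡-Reasoning

  unpad-periodic : ∀ δ f → EventuallyPeriodicSeq (pad δ f) → EventuallyPeriodicSeq f
  unpad-periodic δ f (p , 1≤p , N , per) = p , 1≤p , N , λ i N≤i → begin
    f (i + p)             ≡⟨ sym (pad-shift δ f (i + p)) ⟩
    pad δ f (δ + (i + p)) ≡⟨ cong (pad δ f) (sym (ℕP.+-assoc δ i p)) ⟩
    pad δ f (δ + i + p)   ≡⟨ per (δ + i) (ℕP.≤-trans N≤i (ℕP.m≤n+m i δ)) ⟩
    pad δ f (δ + i)       ≡⟨ pad-shift δ f i ⟩
    f i                   ∎
    where open ≡-Reasoning

module _ where

  open Nat using (_+_; _*_; _≤_; _<_)

  m*m<n*n⇒m<n : ∀ {m n} → m * m < n * n → m < n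
  m*m<n*n⇒m<n {m} {n} lt = ℕP.≰⇒> λ n≤m → ℕP.<⇒≱ lt (ℕP.*-mono-≤ n≤m n≤m)

  square-* : ∀ m n → (m * n) * (m * n) ≡ (m * m) * (n * n)
  square-* = ℕSolver.solve-∀

  NearOrFar : ℕ → ℕ → Set
  NearOrFar x y = x ≡ y ⊎ y ≡ suc x ⊎ x ≡ suc y ⊎ 2 + x ≤ y ⊎ 2 + y ≤ x

  near-or-far : ∀ x y → NearOrFar x y
  near-or-far zero          zero          = inj₁ refl
  near-or-far zero          (suc zero)    = inj₂ (inj₁ refl)
  near-or-far zero          (suc (suc y)) = inj₂ (inj₂ (inj₂ (inj₁ (s≤s (s≤s z≤n)))))
  near-or-far (suc zero)    zero          = inj₂ (inj₂ (inj₁ refl))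
  near-or-far (suc (suc x)) zero          = inj₂ (inj₂ (inj₂ (inj₂ (s≤s (s≤s z≤n)))))
  near-or-far (suc x)       (suc y) with near-or-far x y
  ... | inj₁ x≡y                        = inj₁ (cong suc x≡y)
  ... | inj₂ (inj₁ y≡1+x)               = inj₂ (inj₁ (cong suc y≡1+x))
  ... | inj₂ (inj₂ (inj₁ x≡1+y))        = inj₂ (inj₂ (inj₁ (cong suc x≡1+y)))
  ... | inj₂ (inj₂ (inj₂ (inj₁ 2+x≤y))) = inj₂ (inj₂ (inj₂ (inj₁ (s≤s 2+x≤y))))
  ... | inj₂ (inj₂ (inj₂ (inj₂ 2+y≤x))) = inj₂ (inj₂ (inj₂ (inj₂ (s≤s 2+y≤x))))

  squeeze : ∀ {a x y} k → k + x ≤ a → ¬ (suc (k + x) ≤ y + a) → y ≡ 0 × k + x ≡ a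
  squeeze {a} {y = zero}   k k+x≤a k+x≮a = refl , ℕP.≤∧≮⇒≡ k+x≤a k+x≮a
  squeeze {a} {y = suc y′} k k+x≤a ≮     = ⊥-elim (≮ (s≤s (ℕP.≤-trans k+x≤a (ℕP.m≤n+m a y′))))

module _ where

  open Int using (_+_; _-_; -_; _*_; _<_; _≤_)

  pos-∸ : ∀ {m n} → n Nat.≤ m → + (m Nat.∸ n) ≡ + m - + n
  pos-∸ {m} {n} n≤m = sym (trans (ℤP.m-n≡m⊖n m n) (ℤP.⊖-≥ n≤m))

  square≡pos : ∀ i → i * i ≡ + (Int.∣ i ∣ Nat.* Int.∣ i ∣)
  square≡pos (+ n)        = sym (ℤP.pos-* n n)
  square≡pos Int.-[1+ n ] = refl

  square-nonneg : ∀ i → 0ℤ ≤ i * i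
  square-nonneg i = subst (0ℤ ≤_) (sym (square≡pos i)) (Int.+≤+ z≤n)

  neg-square : ∀ i → - i * - i ≡ i * i
  neg-square = ℤSolver.solve-∀

  *-pos : ∀ {i j} → 0ℤ < i → 0ℤ < j → 0ℤ < i * j
  *-pos {i} 0<i 0<j = subst (_< i * _) (ℤP.*-zeroʳ i) (ℤP.*-monoˡ-<-pos i {{Int.positive 0<i}} 0<j)

  *-nonneg : ∀ {i j} → 0ℤ ≤ i → 0ℤ ≤ j → 0ℤ ≤ i * j
  *-nonneg {i} 0≤i 0≤j = subst (_≤ i * _) (ℤP.*-zeroʳ i) (ℤP.*-monoˡ-≤-nonNeg i {{Int.nonNegative 0≤i}} 0≤j)

  *-mono-<-nonneg : ∀ {i j k l} → 0ℤ ≤ i → i < j → 0ℤ ≤ k → k < l → i * k < j * l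
  *-mono-<-nonneg {i} {j} {k} 0≤i i<j 0≤k k<l = ℤP.≤-<-trans
    (ℤP.*-monoʳ-≤-nonNeg k {{Int.nonNegative 0≤k}} (ℤP.<⇒≤ i<j))
    (ℤP.*-monoˡ-<-pos j {{Int.positive (ℤP.≤-<-trans 0≤i i<j)}} k<l)

  square-<⇒< : ∀ {i j} → 0ℤ ≤ j → i * i < j * j → i < j
  square-<⇒< {i} {j} 0≤j i²<j² = ℤP.≰⇒> λ j≤i → ℤP.<⇒≱ i²<j² (ℤP.≤-trans
    (ℤP.*-monoʳ-≤-nonNeg j {{Int.nonNegative 0≤j}} j≤i)
    (ℤP.*-monoˡ-≤-nonNeg i {{Int.nonNegative (ℤP.≤-trans 0≤j j≤i)}} j≤i))

  square-<⇒0<+ : ∀ {i j} → 0ℤ ≤ j → i * i < j * j → 0ℤ < j + i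
  square-<⇒0<+ {i} {j} 0≤j i²<j² = subst₂ _<_ (ℤP.+-inverseʳ i) (ℤP.+-comm i j)
    (ℤP.+-monoʳ-< i (square-<⇒< 0≤j (subst (_< j * j) (sym (neg-square i)) i²<j²)))

  binomial-< : ∀ {p₁ q₁ p₂ q₂ c e} → 0ℤ ≤ p₁ → p₁ < q₁ → 0ℤ ≤ p₂ → p₂ < q₂ → 0ℤ ≤ e →
               c * c ≡ p₁ * p₂ → e * e ≡ q₁ * q₂ → p₁ + p₂ + (c + c) < q₁ + q₂ + (e + e)
  binomial-< {c = c} {e} 0≤p₁ p₁<q₁ 0≤p₂ p₂<q₂ 0≤e c²≡ e²≡ =
    ℤP.+-mono-< (ℤP.+-mono-< p₁<q₁ p₂<q₂) (ℤP.+-mono-< c<e c<e)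
    where
    c<e : c < e
    c<e = square-<⇒< {c} {e} 0≤e (subst₂ _<_ (sym c²≡) (sym e²≡) (*-mono-<-nonneg 0≤p₁ p₁<q₁ 0≤p₂ p₂<q₂))

  <⇒0<- : ∀ {i j} → i < j → 0ℤ < j - i
  <⇒0<- {i} {j} i<j = subst (_< j - i) (ℤP.+-inverseʳ i) (ℤP.+-monoˡ-< (- i) i<j)

  0<-⇒< : ∀ {i j} → 0ℤ < j - i → i < j
  0<-⇒< {i} {j} 0<j-i = subst₂ _<_ (ℤP.+-identityˡ i) (j-i+i≡j i j) (ℤP.+-monoˡ-< i 0<j-i)
    where
    j-i+i≡j : ∀ i j → j - i + i ≡ j
    j-i+i≡j = ℤSolver.solve-∀

  *-cancel-pos : ∀ {k i} → 0ℤ < k → 0ℤ < k * i → 0ℤ < i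
  *-cancel-pos {k} {i} 0<k 0<ki =
    ℤP.*-cancelˡ-<-nonNeg k {{Int.nonNegative (ℤP.<⇒≤ 0<k)}} (subst (_< k * i) (sym (ℤP.*-zeroʳ k)) 0<ki)

  0<-i⇒i<0 : ∀ {i} → 0ℤ < - i → i < 0ℤ
  0<-i⇒i<0 {i} 0<-i = subst (_< 0ℤ) (ℤP.neg-involutive i) (ℤP.neg-mono-< 0<-i)

-- Irrationality of √(a² + 4)

module NonSquare (D n : ℕ) (n²<D : n Nat.* n Nat.< D) (D<[1+n]² : D Nat.< suc n Nat.* suc n) where

  open Nat using (_*_; _+_; _∸_; _<_; _≤_)

  private
    open Int using () renaming (_+_ to _⊞_; _-_ to _⊟_; _*_ to _⊠_)

    pos-square : ∀ m → + (m * m) ≡ + m ⊠ + m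
    pos-square m = ℤP.pos-* m m

    pos-square-* : ∀ m k → + (m * m * k) ≡ + m ⊠ + m ⊠ + k
    pos-square-* m k = trans (ℤP.pos-* (m * m) k) (cong (_⊠ + k) (pos-square m))

  descent-identity : ∀ {s t} → s * s ≡ t * t * D → t * n ≤ s → n * s ≤ D * t →
                     (D * t ∸ n * s) * (D * t ∸ n * s) ≡ (s ∸ t * n) * (s ∸ t * n) * D
  descent-identity {s} {t} s²≡t²D tn≤s ns≤Dt = ℤP.+-injective (begin
    + (v * v)                                  ≡⟨ pos-square v ⟩
    + v ⊠ + v                                  ≡⟨ cong (λ z → z ⊠ z) v≡ ⟩
    (D′ ⊠ t′ ⊟ n′ ⊠ s′) ⊠ (D′ ⊠ t′ ⊟ n′ ⊠ s′)  ≡⟨ identity D′ n′ s′ t′ ⟩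
    u′ ⊠ u′ ⊠ D′ ⊞ (D′ ⊟ n′ ⊠ n′) ⊠ (t′ ⊠ t′ ⊠ D′ ⊟ s′ ⊠ s′)
                                               ≡⟨ cong (λ z → u′ ⊠ u′ ⊠ D′ ⊞ (D′ ⊟ n′ ⊠ n′) ⊠ z) t²D-s²≡0 ⟩
    u′ ⊠ u′ ⊠ D′ ⊞ (D′ ⊟ n′ ⊠ n′) ⊠ 0ℤ          ≡⟨ +-*-zero (u′ ⊠ u′ ⊠ D′) (D′ ⊟ n′ ⊠ n′) ⟩
    u′ ⊠ u′ ⊠ D′                               ≡⟨ cong (λ z → z ⊠ z ⊠ D′) (sym u≡) ⟩
    + u ⊠ + u ⊠ D′                             ≡⟨ sym (pos-square-* u D) ⟩
    + (u * u * D)                              ∎)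
    where
    open ≡-Reasoning
    u v : ℕ
    u = s ∸ t * n
    v = D * t ∸ n * s
    D′ n′ s′ t′ u′ : ℤ
    D′ = + D
    n′ = + n
    s′ = + s
    t′ = + t
    u′ = s′ ⊟ t′ ⊠ n′
    identity : ∀ D n s t → (D ⊠ t ⊟ n ⊠ s) ⊠ (D ⊠ t ⊟ n ⊠ s)
                         ≡ (s ⊟ t ⊠ n) ⊠ (s ⊟ t ⊠ n) ⊠ D ⊞ (D ⊟ n ⊠ n) ⊠ (t ⊠ t ⊠ D ⊟ s ⊠ s)
    identity = ℤSolver.solve-∀
    +-*-zero : ∀ x y → x ⊞ y ⊠ 0ℤ ≡ x
    +-*-zero = ℤSolver.solve-∀
    v≡ : + v ≡ D′ ⊠ t′ ⊟ n′ ⊠ s′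
    v≡ = trans (pos-∸ ns≤Dt) (cong₂ _⊟_ (ℤP.pos-* D t) (ℤP.pos-* n s))
    u≡ : + u ≡ u′
    u≡ = trans (pos-∸ tn≤s) (cong (s′ ⊟_) (ℤP.pos-* t n))
    t²D-s²≡0 : t′ ⊠ t′ ⊠ D′ ⊟ s′ ⊠ s′ ≡ 0ℤ
    t²D-s²≡0 = ℤP.i≡j⇒i-j≡0 (trans (sym (pos-square-* t D)) (trans (cong +_ (sym s²≡t²D)) (pos-square s)))

  -- A solution with t > 0 yields the smaller one (s - t n, D t - n s), as n < s / t < n + 1.
  descent : ∀ t → (∀ {t′} → t′ < t → ∀ s → s * s ≡ t′ * t′ * D → t′ ≡ 0) →
            ∀ s → s * s ≡ t * t * D → t ≡ 0
  descent zero    _  _ _      = refl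
  descent (suc k) ih s s²≡t²D =
    ⊥-elim (u≢0 (ih u<t (D * t ∸ n * s) (descent-identity s²≡t²D (ℕP.<⇒≤ tn<s) (ℕP.<⇒≤ ns<Dt))))
    where
    t : ℕ
    t = suc k
    open ℕP.≤-Reasoning
    rearrange : ∀ D t → D * (t * t * D) ≡ (D * t) * (D * t)
    rearrange = ℕSolver.solve-∀
    t²D≢0 : Nat.NonZero (t * t * D)
    t²D≢0 = ℕP.m*n≢0 (t * t) D {{_}} {{Nat.>-nonZero (ℕP.≤-<-trans z≤n n²<D)}}
    tn<s : t * n < s
    tn<s = m*m<n*n⇒m<n (begin-strict
      (t * n) * (t * n) ≡⟨ square-* t n ⟩
      (t * t) * (n * n) <⟨ ℕP.*-monoʳ-< (t * t) n²<D ⟩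
      t * t * D         ≡⟨ sym s²≡t²D ⟩
      s * s             ∎)
    s<tn+t : s < t * n + t
    s<tn+t = m*m<n*n⇒m<n (begin-strict
      s * s                     ≡⟨ s²≡t²D ⟩
      t * t * D                 <⟨ ℕP.*-monoʳ-< (t * t) D<[1+n]² ⟩
      (t * t) * (suc n * suc n) ≡⟨ sym (square-* t (suc n)) ⟩
      (t * suc n) * (t * suc n) ≡⟨ cong (λ z → z * z) (ℕP.*-suc t n) ⟩
      (t + t * n) * (t + t * n) ≡⟨ cong (λ z → z * z) (ℕP.+-comm t (t * n)) ⟩
      (t * n + t) * (t * n + t) ∎)
    ns<Dt : n * s < D * t
    ns<Dt = m*m<n*n⇒m<n (begin-strict
      (n * s) * (n * s)     ≡⟨ square-* n s ⟩
      (n * n) * (s * s)     ≡⟨ cong ((n * n) *_) s²≡t²D ⟩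
      (n * n) * (t * t * D) <⟨ ℕP.*-monoˡ-< (t * t * D) {{t²D≢0}} n²<D ⟩
      D * (t * t * D)       ≡⟨ rearrange D t ⟩
      (D * t) * (D * t)     ∎)
    u : ℕ
    u = s ∸ t * n
    u<t : u < t
    u<t = ℕP.+-cancelˡ-< (t * n) u t (subst (_< t * n + t) (sym (ℕP.m+[n∸m]≡n (ℕP.<⇒≤ tn<s))) s<tn+t)
    u≢0 : u ≢ 0
    u≢0 u≡0 = ℕP.<⇒≱ tn<s (ℕP.m∸n≡0⇒m≤n u≡0)

  no-rational-root : ∀ t s → s * s ≡ t * t * D → t ≡ 0
  no-rational-root = <-rec _ descent

  no-integral-root : ∀ s t → s ⊠ s ≡ t ⊠ t ⊠ + D → t ≡ 0ℤ
  no-integral-root s t s²≡t²D = ℤP.∣i∣≡0⇒i≡0 (no-rational-root Int.∣ t ∣ Int.∣ s ∣ (ℤP.+-injective (begin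
    + (Int.∣ s ∣ * Int.∣ s ∣)       ≡⟨ sym (square≡pos s) ⟩
    s ⊠ s                           ≡⟨ s²≡t²D ⟩
    t ⊠ t ⊠ + D                     ≡⟨ cong (_⊠ + D) (square≡pos t) ⟩
    + (Int.∣ t ∣ * Int.∣ t ∣) ⊠ + D ≡⟨ sym (ℤP.pos-* (Int.∣ t ∣ * Int.∣ t ∣) D) ⟩
    + (Int.∣ t ∣ * Int.∣ t ∣ * D)   ∎)))
    where open ≡-Reasoning

-- a² < a² + 4 < (a + 1)² for a ≥ 2, and 2² < 5 < 3².
Δ-nonsquare : ∀ {a} → 1 Nat.≤ a → ∀ s t → s Int.* s ≡ t Int.* t Int.* Δ a → t ≡ 0ℤ
Δ-nonsquare {suc zero}    _ = NonSquare.no-integral-root 5 2 (ℕP.n<1+n 4) (ℕP.m<m+n 5 (s≤s z≤n))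
Δ-nonsquare {suc (suc b)} _ =
  NonSquare.no-integral-root (a * a + 4) a (ℕP.m<m+n (a * a) (s≤s z≤n))
    (subst (a * a + 4 <_) (sym (expand b)) (ℕP.m<m+n (a * a + 4) (s≤s z≤n)))
  where
  open Nat using (_+_; _*_; _<_)
  a : ℕ
  a = 2 + b
  expand : ∀ b → (3 + b) * (3 + b) ≡ (2 + b) * (2 + b) + 4 + suc (b + b)
  expand = ℕSolver.solve-∀

-- Positivity in ℤ[√D]

module RealQuadratic (D : ℤ) (0<D : 0ℤ Int.< D) (nonsquare : ∀ s t → s Int.* s ≡ t Int.* t Int.* D → t ≡ 0ℤ) where

  open Int using (_+_; _-_; -_; _*_; _<_; _≤_)

  PosA PosB Pos√ : ℤ → ℤ → Set
  PosA s t = 0ℤ < s × t * t * D < s * s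
  PosB s t = 0ℤ < t × s * s < t * t * D
  -- Pos√ s t states that the real number s + t √D is positive.
  Pos√ s t = PosA s t ⊎ PosB s t

  private
    square-D-nonneg : ∀ t → 0ℤ ≤ t * t * D
    square-D-nonneg t = *-nonneg (square-nonneg t) (ℤP.<⇒≤ 0<D)

    expand-square : ∀ x y → (x + y) * (x + y) ≡ x * x + y * y + (x * y + x * y)
    expand-square = ℤSolver.solve-∀

    expand-square-D : ∀ x y d → (x + y) * (x + y) * d ≡ x * x * d + y * y * d + (x * y * d + x * y * d)
    expand-square-D = ℤSolver.solve-∀

    square-of-* : ∀ x y → (x * y) * (x * y) ≡ (x * x) * (y * y)
    square-of-* = ℤSolver.solve-∀

    square-of-*-D : ∀ x y d → (x * y * d) * (x * y * d) ≡ (x * x * d) * (y * y * d)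
    square-of-*-D = ℤSolver.solve-∀

    scale-D : ∀ k t → (k * t) * (k * t) * D ≡ (k * k) * (t * t * D)
    scale-D k t = identity k t D
      where
      identity : ∀ k t d → (k * t) * (k * t) * d ≡ (k * k) * (t * t * d)
      identity = ℤSolver.solve-∀

  PosA-+ : ∀ {s₁ t₁ s₂ t₂} → PosA s₁ t₁ → PosA s₂ t₂ → PosA (s₁ + s₂) (t₁ + t₂)
  PosA-+ {s₁} {t₁} {s₂} {t₂} (0<s₁ , t₁²D<s₁²) (0<s₂ , t₂²D<s₂²) =
    ℤP.+-mono-< 0<s₁ 0<s₂ ,
    subst₂ _<_ (sym (expand-square-D t₁ t₂ D)) (sym (expand-square s₁ s₂))
      (binomial-< {t₁ * t₁ * D} {s₁ * s₁} {t₂ * t₂ * D} {s₂ * s₂} {t₁ * t₂ * D} {s₁ * s₂}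
                  (square-D-nonneg t₁) t₁²D<s₁² (square-D-nonneg t₂) t₂²D<s₂²
                  (ℤP.<⇒≤ (*-pos 0<s₁ 0<s₂)) (square-of-*-D t₁ t₂ D) (square-of-* s₁ s₂))

  PosB-+ : ∀ {s₁ t₁ s₂ t₂} → PosB s₁ t₁ → PosB s₂ t₂ → PosB (s₁ + s₂) (t₁ + t₂)
  PosB-+ {s₁} {t₁} {s₂} {t₂} (0<t₁ , s₁²<t₁²D) (0<t₂ , s₂²<t₂²D) =
    ℤP.+-mono-< 0<t₁ 0<t₂ ,
    subst₂ _<_ (sym (expand-square s₁ s₂)) (sym (expand-square-D t₁ t₂ D))
      (binomial-< {s₁ * s₁} {t₁ * t₁ * D} {s₂ * s₂} {t₂ * t₂ * D} {s₁ * s₂} {t₁ * t₂ * D}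
                  (square-nonneg s₁) s₁²<t₁²D (square-nonneg s₂) s₂²<t₂²D
                  (ℤP.<⇒≤ (*-pos (*-pos 0<t₁ 0<t₂) 0<D)) (square-of-* s₁ s₂) (square-of-*-D t₁ t₂ D))

  Pos√-asym : ∀ {s t} → Pos√ s t → ¬ Pos√ (- s) (- t)
  Pos√-asym (inj₁ (0<s , _)) (inj₁ (0<-s , _)) = ℤP.<-asym 0<s (0<-i⇒i<0 0<-s)
  Pos√-asym (inj₂ (0<t , _)) (inj₂ (0<-t , _)) = ℤP.<-asym 0<t (0<-i⇒i<0 0<-t)
  Pos√-asym {s} {t} (inj₁ (_ , t²D<s²)) (inj₂ (_ , s²<t²D)) =
    ℤP.<-asym t²D<s² (subst₂ _<_ (neg-square s) (cong (_* D) (neg-square t)) s²<t²D)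
  Pos√-asym {s} {t} (inj₂ (_ , s²<t²D)) (inj₁ (_ , t²D<s²)) =
    ℤP.<-asym s²<t²D (subst₂ _<_ (cong (_* D) (neg-square t)) (neg-square s) t²D<s²)

  Pos√-trichotomy : ∀ s t → Pos√ s t ⊎ (s ≡ 0ℤ × t ≡ 0ℤ) ⊎ Pos√ (- s) (- t)
  Pos√-trichotomy s t with ℤP.<-cmp (s * s) (t * t * D)
  ... | tri≈ _ s²≡t²D _ = inj₂ (inj₁ (square≡0 (trans s²≡t²D (cong (λ z → z * z * D) t≡0)) , t≡0))
    where
    t≡0 : t ≡ 0ℤ
    t≡0 = nonsquare s t s²≡t²D
    square≡0 : s * s ≡ 0ℤ → s ≡ 0ℤ
    square≡0 s²≡0 = [ id , id ]′ (ℤP.i*j≡0⇒i≡0∨j≡0 s s²≡0)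
  ... | tri< s²<t²D _ _ with ℤP.<-cmp 0ℤ t
  ...   | tri< 0<t _ _ = inj₁ (inj₂ (0<t , s²<t²D))
  ...   | tri≈ _ refl _ = ⊥-elim (ℤP.<⇒≱ s²<t²D (square-nonneg s))
  ...   | tri> _ _ t<0 = inj₂ (inj₂ (inj₂ (ℤP.neg-mono-< t<0 ,
                           subst₂ _<_ (sym (neg-square s)) (cong (_* D) (sym (neg-square t))) s²<t²D)))
  Pos√-trichotomy s t | tri> _ _ t²D<s² with ℤP.<-cmp 0ℤ s
  ...   | tri< 0<s _ _ = inj₁ (inj₁ (0<s , t²D<s²))
  ...   | tri≈ _ refl _ = ⊥-elim (ℤP.<⇒≱ t²D<s² (square-D-nonneg t))
  ...   | tri> _ _ s<0 = inj₂ (inj₂ (inj₁ (ℤP.neg-mono-< s<0 ,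
                           subst₂ _<_ (cong (_* D) (sym (neg-square t))) (sym (neg-square s)) t²D<s²)))

  private
    neg-+-cancelˡ : ∀ x y → - (x + y) + x ≡ - y
    neg-+-cancelˡ = ℤSolver.solve-∀

    neg-+-cancelʳ : ∀ x y → - (x + y) + y ≡ - x
    neg-+-cancelʳ = ℤSolver.solve-∀

    neg-+-cancel : ∀ x y → - x + (x + y) ≡ y
    neg-+-cancel = ℤSolver.solve-∀

    +≡0⇒≡neg : ∀ {x y} → x + y ≡ 0ℤ → y ≡ - x
    +≡0⇒≡neg {x} {y} x+y≡0 = trans (sym (neg-+-cancel x y)) (trans (cong (_+_ (- x)) x+y≡0) (ℤP.+-identityʳ (- x)))

  -- If the sum were not positive, moving it to the other side would make one summand negative.
  PosA+PosB : ∀ {s₁ t₁ s₂ t₂} → PosA s₁ t₁ → PosB s₂ t₂ → Pos√ (s₁ + s₂) (t₁ + t₂)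
  PosA+PosB {s₁} {t₁} {s₂} {t₂} A B with Pos√-trichotomy (s₁ + s₂) (t₁ + t₂)
  ... | inj₁ pos = pos
  ... | inj₂ (inj₁ (s≡0 , t≡0)) = ⊥-elim (Pos√-asym {s₁} {t₁} (inj₁ A)
          (subst₂ Pos√ (+≡0⇒≡neg s≡0) (+≡0⇒≡neg t≡0) (inj₂ B)))
  ... | inj₂ (inj₂ (inj₁ A′)) = ⊥-elim (Pos√-asym {s₂} {t₂} (inj₂ B)
          (subst₂ Pos√ (neg-+-cancelˡ s₁ s₂) (neg-+-cancelˡ t₁ t₂)
            (inj₁ (PosA-+ { - (s₁ + s₂)} { - (t₁ + t₂)} {s₁} {t₁} A′ A))))
  ... | inj₂ (inj₂ (inj₂ B′)) = ⊥-elim (Pos√-asym {s₁} {t₁} (inj₁ A)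
          (subst₂ Pos√ (neg-+-cancelʳ s₁ s₂) (neg-+-cancelʳ t₁ t₂)
            (inj₂ (PosB-+ { - (s₁ + s₂)} { - (t₁ + t₂)} {s₂} {t₂} B′ B))))

  Pos√-+ : ∀ {s₁ t₁ s₂ t₂} → Pos√ s₁ t₁ → Pos√ s₂ t₂ → Pos√ (s₁ + s₂) (t₁ + t₂)
  Pos√-+ {s₁} {t₁} {s₂} {t₂} (inj₁ A₁) (inj₁ A₂) = inj₁ (PosA-+ {s₁} {t₁} {s₂} {t₂} A₁ A₂)
  Pos√-+ {s₁} {t₁} {s₂} {t₂} (inj₂ B₁) (inj₂ B₂) = inj₂ (PosB-+ {s₁} {t₁} {s₂} {t₂} B₁ B₂)
  Pos√-+ {s₁} {t₁} {s₂} {t₂} (inj₁ A₁) (inj₂ B₂) = PosA+PosB {s₁} {t₁} {s₂} {t₂} A₁ B₂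
  Pos√-+ {s₁} {t₁} {s₂} {t₂} (inj₂ B₁) (inj₁ A₂) =
    subst₂ Pos√ (ℤP.+-comm s₂ s₁) (ℤP.+-comm t₂ t₁) (PosA+PosB {s₂} {t₂} {s₁} {t₁} A₂ B₁)

  Pos√-coords : ∀ {s t} → 0ℤ ≤ s → 0ℤ ≤ t → (s ≡ 0ℤ × t ≡ 0ℤ) ⊎ Pos√ s t
  Pos√-coords {s} {t} 0≤s 0≤t with Pos√-trichotomy s t
  ... | inj₁ pos = inj₂ pos
  ... | inj₂ (inj₁ s,t≡0) = inj₁ s,t≡0
  ... | inj₂ (inj₂ (inj₁ (0<-s , _))) = ⊥-elim (ℤP.<⇒≱ (0<-i⇒i<0 0<-s) 0≤s)
  ... | inj₂ (inj₂ (inj₂ (0<-t , _))) = ⊥-elim (ℤP.<⇒≱ (0<-i⇒i<0 0<-t) 0≤t)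

  private
    Norm : ℤ → ℤ → ℤ
    Norm s t = s * s - t * t * D

    norm-* : ∀ s₁ t₁ s₂ t₂ → Norm (s₁ * s₂ + t₁ * t₂ * D) (s₁ * t₂ + t₁ * s₂) ≡ Norm s₁ t₁ * Norm s₂ t₂
    norm-* s₁ t₁ s₂ t₂ = identity s₁ t₁ s₂ t₂ D
      where
      identity : ∀ s₁ t₁ s₂ t₂ d →
        (s₁ * s₂ + t₁ * t₂ * d) * (s₁ * s₂ + t₁ * t₂ * d) - (s₁ * t₂ + t₁ * s₂) * (s₁ * t₂ + t₁ * s₂) * d
        ≡ (s₁ * s₁ - t₁ * t₁ * d) * (s₂ * s₂ - t₂ * t₂ * d)
      identity = ℤSolver.solve-∀

    neg-norm : ∀ s t → - Norm s t ≡ t * t * D - s * s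
    neg-norm s t = identity s t D
      where
      identity : ∀ s t d → - (s * s - t * t * d) ≡ t * t * d - s * s
      identity = ℤSolver.solve-∀

    PosA⇒0<norm : ∀ {s t} → PosA s t → 0ℤ < Norm s t
    PosA⇒0<norm (_ , t²D<s²) = <⇒0<- t²D<s²

    PosB⇒0<-norm : ∀ {s t} → PosB s t → 0ℤ < - Norm s t
    PosB⇒0<-norm {s} {t} (_ , s²<t²D) = subst (0ℤ <_) (sym (neg-norm s t)) (<⇒0<- s²<t²D)

    0<norm⇒ : ∀ {s t} → 0ℤ < Norm s t → t * t * D < s * s
    0<norm⇒ = 0<-⇒<

    0<-norm⇒ : ∀ {s t} → 0ℤ < - Norm s t → s * s < t * t * D
    0<-norm⇒ {s} {t} 0<-N = 0<-⇒< (subst (0ℤ <_) (neg-norm s t) 0<-N)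

    neg-*-neg : ∀ x y → - x * - y ≡ x * y
    neg-*-neg = ℤSolver.solve-∀

    *-neg : ∀ x y → x * - y ≡ - (x * y)
    *-neg = ℤSolver.solve-∀

    cross-square : ∀ s₁ t₁ s₂ t₂ d → (t₁ * t₁ * d) * (s₂ * s₂) ≡ d * ((t₁ * s₂) * (t₁ * s₂))
    cross-square = ℤSolver.solve-∀

    cross-square′ : ∀ s₁ t₁ s₂ t₂ d → (s₁ * s₁) * (t₂ * t₂ * d) ≡ d * ((s₁ * t₂) * (s₁ * t₂))
    cross-square′ = ℤSolver.solve-∀

  PosA*PosB : ∀ {s₁ t₁ s₂ t₂} → PosA s₁ t₁ → PosB s₂ t₂ → PosB (s₁ * s₂ + t₁ * t₂ * D) (s₁ * t₂ + t₁ * s₂)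
  PosA*PosB {s₁} {t₁} {s₂} {t₂} A@(0<s₁ , t₁²D<s₁²) B@(0<t₂ , s₂²<t₂²D) =
    square-<⇒0<+ {t₁ * s₂} {s₁ * t₂} (ℤP.<⇒≤ (*-pos 0<s₁ 0<t₂))
      (ℤP.*-cancelˡ-<-nonNeg D {{Int.nonNegative (ℤP.<⇒≤ 0<D)}}
        (subst₂ _<_ (cross-square s₁ t₁ s₂ t₂ D) (cross-square′ s₁ t₁ s₂ t₂ D)
          (*-mono-<-nonneg (square-D-nonneg t₁) t₁²D<s₁² (square-nonneg s₂) s₂²<t₂²D))) ,
    0<-norm⇒ {s₁ * s₂ + t₁ * t₂ * D} {s₁ * t₂ + t₁ * s₂}
      (subst (0ℤ <_) (trans (*-neg (Norm s₁ t₁) (Norm s₂ t₂)) (cong -_ (sym (norm-* s₁ t₁ s₂ t₂))))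
             (*-pos (PosA⇒0<norm {s₁} {t₁} A) (PosB⇒0<-norm {s₂} {t₂} B)))

  Pos√-* : ∀ {s₁ t₁ s₂ t₂} → Pos√ s₁ t₁ → Pos√ s₂ t₂ → Pos√ (s₁ * s₂ + t₁ * t₂ * D) (s₁ * t₂ + t₁ * s₂)
  Pos√-* {s₁} {t₁} {s₂} {t₂} (inj₁ A₁@(0<s₁ , t₁²D<s₁²)) (inj₁ A₂@(0<s₂ , t₂²D<s₂²)) = inj₁ (
    square-<⇒0<+ {t₁ * t₂ * D} {s₁ * s₂} (ℤP.<⇒≤ (*-pos 0<s₁ 0<s₂))
      (subst₂ _<_ (sym (square-of-*-D t₁ t₂ D)) (sym (square-of-* s₁ s₂))
        (*-mono-<-nonneg (square-D-nonneg t₁) t₁²D<s₁² (square-D-nonneg t₂) t₂²D<s₂²)) ,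
    0<norm⇒ {s₁ * s₂ + t₁ * t₂ * D} {s₁ * t₂ + t₁ * s₂}
      (subst (0ℤ <_) (sym (norm-* s₁ t₁ s₂ t₂)) (*-pos (PosA⇒0<norm {s₁} {t₁} A₁) (PosA⇒0<norm {s₂} {t₂} A₂))))
  Pos√-* {s₁} {t₁} {s₂} {t₂} (inj₂ B₁@(0<t₁ , s₁²<t₁²D)) (inj₂ B₂@(0<t₂ , s₂²<t₂²D)) = inj₁ (
    subst (0ℤ <_) (ℤP.+-comm (t₁ * t₂ * D) (s₁ * s₂))
      (square-<⇒0<+ {s₁ * s₂} {t₁ * t₂ * D} (ℤP.<⇒≤ (*-pos (*-pos 0<t₁ 0<t₂) 0<D))
        (subst₂ _<_ (sym (square-of-* s₁ s₂)) (sym (square-of-*-D t₁ t₂ D))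
          (*-mono-<-nonneg (square-nonneg s₁) s₁²<t₁²D (square-nonneg s₂) s₂²<t₂²D))) ,
    0<norm⇒ {s₁ * s₂ + t₁ * t₂ * D} {s₁ * t₂ + t₁ * s₂}
      (subst (0ℤ <_) (trans (neg-*-neg (Norm s₁ t₁) (Norm s₂ t₂)) (sym (norm-* s₁ t₁ s₂ t₂)))
             (*-pos (PosB⇒0<-norm {s₁} {t₁} B₁) (PosB⇒0<-norm {s₂} {t₂} B₂))))
  Pos√-* {s₁} {t₁} {s₂} {t₂} (inj₁ A₁) (inj₂ B₂) = inj₂ (PosA*PosB {s₁} {t₁} {s₂} {t₂} A₁ B₂)
  Pos√-* {s₁} {t₁} {s₂} {t₂} (inj₂ B₁) (inj₁ A₂) =
    inj₂ (subst₂ PosB (swap-first s₂ t₂ s₁ t₁ D) (swap-second s₂ t₂ s₁ t₁) (PosA*PosB {s₂} {t₂} {s₁} {t₁} A₂ B₁))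
    where
    swap-first : ∀ s₂ t₂ s₁ t₁ d → s₂ * s₁ + t₂ * t₁ * d ≡ s₁ * s₂ + t₁ * t₂ * d
    swap-first = ℤSolver.solve-∀
    swap-second : ∀ s₂ t₂ s₁ t₁ → s₂ * t₁ + t₂ * s₁ ≡ s₁ * t₂ + t₁ * s₂
    swap-second = ℤSolver.solve-∀

  Pos√-cancel : ∀ {k s t} → 0ℤ < k → Pos√ (k * s) (k * t) → Pos√ s t
  Pos√-cancel {k} {s} {t} 0<k (inj₁ (0<ks , [kt]²D<[ks]²)) =
    inj₁ (*-cancel-pos 0<k 0<ks , cancel-k² (subst₂ _<_ (scale-D k t) (square-of-* k s) [kt]²D<[ks]²))
    where
    cancel-k² = ℤP.*-cancelˡ-<-nonNeg (k * k) {{Int.nonNegative (square-nonneg k)}}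
  Pos√-cancel {k} {s} {t} 0<k (inj₂ (0<kt , [ks]²<[kt]²D)) =
    inj₂ (*-cancel-pos 0<k 0<kt , cancel-k² (subst₂ _<_ (square-of-* k s) (scale-D k t) [ks]²<[kt]²D))
    where
    cancel-k² = ℤP.*-cancelˡ-<-nonNeg (k * k) {{Int.nonNegative (square-nonneg k)}}

module QuadraticPisot (a : ℕ) (1≤a : 1 Nat.≤ a) where

  infixl 6 _+_ _-_
  infixl 7 _*_
  infix  8 -_
  infixr 8 _^_

  open Int using () renaming (_+_ to _⊞_; _-_ to _⊟_; _*_ to _⊠_)

  _+_ : ℤβ → ℤβ → ℤβ
  _+_ = _⊕_

  -- The product of Defs.mulβ with the factor a moved to the right, so that
  -- the ring solver can evaluate products of its integer constants.
  _*_ : ℤβ → ℤβ → ℤβ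
  (m , n) * (p , q) = (m ⊠ p ⊞ n ⊠ q , m ⊠ q ⊞ n ⊠ p ⊞ n ⊠ q ⊠ + a)

  -_ : ℤβ → ℤβ
  - (m , n) = (Int.- m , Int.- n)

  _-_ : ℤβ → ℤβ → ℤβ
  x - y = x + - y

  0β 1β : ℤβ
  0β = ι 0ℤ
  1β = ι 1ℤ

  mulβ≡* : ∀ x y → mulβ a x y ≡ x * y
  mulβ≡* (m , n) (p , q) = cong (m ⊠ p ⊞ n ⊠ q ,_) (move-a (+ a) m n p q)
    where
    move-a : ∀ A m n p q → m ⊠ q ⊞ n ⊠ p ⊞ A ⊠ n ⊠ q ≡ m ⊠ q ⊞ n ⊠ p ⊞ n ⊠ q ⊠ A
    move-a = ℤSolver.solve-∀

  +-assoc : ∀ x y z → (x + y) + z ≡ x + (y + z)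
  +-assoc (x₁ , x₂) (y₁ , y₂) (z₁ , z₂) = cong₂ _,_ (ℤP.+-assoc x₁ y₁ z₁) (ℤP.+-assoc x₂ y₂ z₂)

  +-comm : ∀ x y → x + y ≡ y + x
  +-comm (x₁ , x₂) (y₁ , y₂) = cong₂ _,_ (ℤP.+-comm x₁ y₁) (ℤP.+-comm x₂ y₂)

  +-identityˡ : ∀ x → 0β + x ≡ x
  +-identityˡ (x₁ , x₂) = cong₂ _,_ (ℤP.+-identityˡ x₁) (ℤP.+-identityˡ x₂)

  +-inverseʳ : ∀ x → x - x ≡ 0β
  +-inverseʳ (x₁ , x₂) = cong₂ _,_ (ℤP.+-inverseʳ x₁) (ℤP.+-inverseʳ x₂)

  *-assoc : ∀ x y z → (x * y) * z ≡ x * (y * z)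
  *-assoc (x₁ , x₂) (y₁ , y₂) (z₁ , z₂) =
    cong₂ _,_ (first (+ a) x₁ x₂ y₁ y₂ z₁ z₂) (second (+ a) x₁ x₂ y₁ y₂ z₁ z₂)
    where
    first : ∀ A x₁ x₂ y₁ y₂ z₁ z₂ →
      (x₁ ⊠ y₁ ⊞ x₂ ⊠ y₂) ⊠ z₁ ⊞ (x₁ ⊠ y₂ ⊞ x₂ ⊠ y₁ ⊞ x₂ ⊠ y₂ ⊠ A) ⊠ z₂
      ≡ x₁ ⊠ (y₁ ⊠ z₁ ⊞ y₂ ⊠ z₂) ⊞ x₂ ⊠ (y₁ ⊠ z₂ ⊞ y₂ ⊠ z₁ ⊞ y₂ ⊠ z₂ ⊠ A)
    first = ℤSolver.solve-∀
    second : ∀ A x₁ x₂ y₁ y₂ z₁ z₂ →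
      (x₁ ⊠ y₁ ⊞ x₂ ⊠ y₂) ⊠ z₂ ⊞ (x₁ ⊠ y₂ ⊞ x₂ ⊠ y₁ ⊞ x₂ ⊠ y₂ ⊠ A) ⊠ z₁
        ⊞ (x₁ ⊠ y₂ ⊞ x₂ ⊠ y₁ ⊞ x₂ ⊠ y₂ ⊠ A) ⊠ z₂ ⊠ A
      ≡ x₁ ⊠ (y₁ ⊠ z₂ ⊞ y₂ ⊠ z₁ ⊞ y₂ ⊠ z₂ ⊠ A) ⊞ x₂ ⊠ (y₁ ⊠ z₁ ⊞ y₂ ⊠ z₂)
        ⊞ x₂ ⊠ (y₁ ⊠ z₂ ⊞ y₂ ⊠ z₁ ⊞ y₂ ⊠ z₂ ⊠ A) ⊠ A
    second = ℤSolver.solve-∀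

  *-comm : ∀ x y → x * y ≡ y * x
  *-comm (x₁ , x₂) (y₁ , y₂) = cong₂ _,_ (first x₁ x₂ y₁ y₂) (second (+ a) x₁ x₂ y₁ y₂)
    where
    first : ∀ x₁ x₂ y₁ y₂ → x₁ ⊠ y₁ ⊞ x₂ ⊠ y₂ ≡ y₁ ⊠ x₁ ⊞ y₂ ⊠ x₂
    first = ℤSolver.solve-∀
    second : ∀ A x₁ x₂ y₁ y₂ → x₁ ⊠ y₂ ⊞ x₂ ⊠ y₁ ⊞ x₂ ⊠ y₂ ⊠ A ≡ y₁ ⊠ x₂ ⊞ y₂ ⊠ x₁ ⊞ y₂ ⊠ x₂ ⊠ A
    second = ℤSolver.solve-∀

  *-identityˡ : ∀ x → 1β * x ≡ x
  *-identityˡ (x₁ , x₂) = cong₂ _,_ (first x₁ x₂) (second (+ a) x₁ x₂)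
    where
    first : ∀ x₁ x₂ → 1ℤ ⊠ x₁ ⊞ 0ℤ ⊠ x₂ ≡ x₁
    first = ℤSolver.solve-∀
    second : ∀ A x₁ x₂ → 1ℤ ⊠ x₂ ⊞ 0ℤ ⊠ x₁ ⊞ 0ℤ ⊠ x₂ ⊠ A ≡ x₂
    second = ℤSolver.solve-∀

  *-distribˡ-+ : ∀ x y z → x * (y + z) ≡ x * y + x * z
  *-distribˡ-+ (x₁ , x₂) (y₁ , y₂) (z₁ , z₂) =
    cong₂ _,_ (first x₁ x₂ y₁ y₂ z₁ z₂) (second (+ a) x₁ x₂ y₁ y₂ z₁ z₂)
    where
    first : ∀ x₁ x₂ y₁ y₂ z₁ z₂ →
      x₁ ⊠ (y₁ ⊞ z₁) ⊞ x₂ ⊠ (y₂ ⊞ z₂) ≡ (x₁ ⊠ y₁ ⊞ x₂ ⊠ y₂) ⊞ (x₁ ⊠ z₁ ⊞ x₂ ⊠ z₂)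
    first = ℤSolver.solve-∀
    second : ∀ A x₁ x₂ y₁ y₂ z₁ z₂ →
      x₁ ⊠ (y₂ ⊞ z₂) ⊞ x₂ ⊠ (y₁ ⊞ z₁) ⊞ x₂ ⊠ (y₂ ⊞ z₂) ⊠ A
      ≡ (x₁ ⊠ y₂ ⊞ x₂ ⊠ y₁ ⊞ x₂ ⊠ y₂ ⊠ A) ⊞ (x₁ ⊠ z₂ ⊞ x₂ ⊠ z₁ ⊞ x₂ ⊠ z₂ ⊠ A)
    second = ℤSolver.solve-∀

  isCommutativeRing : IsCommutativeRing _≡_ _+_ _*_ -_ 0β 1β
  isCommutativeRing = record
    { isRing = record
      { +-isAbelianGroup = record
        { isGroup = record
          { isMonoid = record
            { isSemigroup = record
              { isMagma = record { isEquivalence = isEquivalence ; ∙-cong = cong₂ _+_ }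
              ; assoc   = +-assoc
              }
            ; identity = +-identityˡ , λ x → trans (+-comm x 0β) (+-identityˡ x)
            }
          ; inverse = (λ x → trans (+-comm (- x) x) (+-inverseʳ x)) , +-inverseʳ
          ; ⁻¹-cong = cong (-_)
          }
        ; comm = +-comm
        }
      ; *-cong     = cong₂ _*_
      ; *-assoc    = *-assoc
      ; *-identity = *-identityˡ , λ x → trans (*-comm x 1β) (*-identityˡ x)
      ; distrib    = *-distribˡ-+ , λ x y z → trans (*-comm (y + z) x)
                       (trans (*-distribˡ-+ x y z) (cong₂ _+_ (*-comm x y) (*-comm x z)))
      }
    ; *-comm = *-comm
    }

  commutativeRing : CommutativeRing 0ℓ 0ℓ
  commutativeRing = record { isCommutativeRing = isCommutativeRing }

  ring : ACR.AlmostCommutativeRing 0ℓ 0ℓ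
  ring = ACR.fromCommutativeRing commutativeRing isZero
    where
    isZero : ∀ x → Maybe (0β ≡ x)
    isZero (+ zero , + zero) = just refl
    isZero _                 = nothing

  _^_ : ℤβ → ℕ → ℤβ
  x ^ zero  = 1β
  x ^ suc n = x * x ^ n

  powβ≡^ : ∀ x n → powβ a x n ≡ x ^ n
  powβ≡^ x zero    = refl
  powβ≡^ x (suc n) = trans (mulβ≡* x (powβ a x n)) (cong (x *_) (powβ≡^ x n))

  β β⁻¹ : ℤβ
  β   = (0ℤ , 1ℤ)
  β⁻¹ = (Int.- + a , 1ℤ)

  β*β⁻¹≡1 : β * β⁻¹ ≡ 1β
  β*β⁻¹≡1 = cong (1ℤ ,_) (cancel (+ a))
    where
    cancel : ∀ A → 0ℤ ⊠ 1ℤ ⊞ 1ℤ ⊠ Int.- A ⊞ 1ℤ ⊠ 1ℤ ⊠ A ≡ 0ℤ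
    cancel = ℤSolver.solve-∀

  β⁻¹*β≡1 : β⁻¹ * β ≡ 1β
  β⁻¹*β≡1 = trans (*-comm β⁻¹ β) β*β⁻¹≡1

  α≡-β⁻¹ : αβ a ≡ - β⁻¹
  α≡-β⁻¹ = cong (_, Int.- 1ℤ) (sym (ℤP.neg-involutive (+ a)))

  ι-* : ∀ m n → ι (m ⊠ n) ≡ ι m * ι n
  ι-* m n = cong₂ _,_ (sym (ℤP.+-identityʳ (m ⊠ n))) (sym (vanish (+ a) m n))
    where
    vanish : ∀ A m n → m ⊠ 0ℤ ⊞ 0ℤ ⊠ n ⊞ 0ℤ ⊠ 0ℤ ⊠ A ≡ 0ℤ
    vanish = ℤSolver.solve-∀

  ^-+ : ∀ x m n → x ^ (m Nat.+ n) ≡ x ^ m * x ^ n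
  ^-+ x zero    n = sym (*-identityˡ (x ^ n))
  ^-+ x (suc m) n = trans (cong (x *_) (^-+ x m n)) (sym (*-assoc x (x ^ m) (x ^ n)))

  *-^ : ∀ x y n → (x * y) ^ n ≡ x ^ n * y ^ n
  *-^ x y zero    = sym (*-identityˡ 1β)
  *-^ x y (suc n) = trans (cong ((x * y) *_) (*-^ x y n)) (shuffle x y (x ^ n) (y ^ n))
    where
    shuffle : ∀ x y u v → (x * y) * (u * v) ≡ (x * u) * (y * v)
    shuffle = solve-∀ ring

  1β^ : ∀ n → 1β ^ n ≡ 1β
  1β^ zero    = refl
  1β^ (suc n) = trans (*-identityˡ (1β ^ n)) (1β^ n)

  inverse-powers : ∀ {u v} → u * v ≡ 1β → ∀ n → u ^ n * v ^ n ≡ 1β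
  inverse-powers {u} {v} uv≡1 n = trans (sym (*-^ u v n)) (trans (cong (_^ n) uv≡1) (1β^ n))

  ι-^ : ∀ m n → ι (+ (m Nat.^ n)) ≡ ι (+ m) ^ n
  ι-^ m zero    = refl
  ι-^ m (suc n) = trans (cong ι (ℤP.pos-* m (m Nat.^ n))) (trans (ι-* (+ m) (+ (m Nat.^ n))) (cong (ι (+ m) *_) (ι-^ m n)))

  private
    0<Δ : 0ℤ Int.< Δ a
    0<Δ = Int.+<+ (ℕP.<-≤-trans (s≤s z≤n) (ℕP.m≤n+m 4 (a Nat.* a)))

    Δ≡ : Δ a ≡ + a ⊠ + a ⊞ + 4
    Δ≡ = trans (ℤP.pos-+ (a Nat.* a) 4) (cong (_⊞ + 4) (ℤP.pos-* a a))

  open RealQuadratic (Δ a) 0<Δ (Δ-nonsquare 1≤a)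

  infix 4 _<_ _≤_

  -- 2 (p + q β) = (2 p + q a) + q √Δ.
  Pos : ℤβ → Set
  Pos (p , q) = Pos√ (+ 2 ⊠ p ⊞ q ⊠ + a) q

  NonNeg : ℤβ → Set
  NonNeg x = x ≡ 0β ⊎ Pos x

  record _<_ (x y : ℤβ) : Set where
    constructor pos
    field positive : Pos (y - x)

  record _≤_ (x y : ℤβ) : Set where
    constructor nonneg
    field nonNegative : NonNeg (y - x)

  Pos-+ : ∀ x y → Pos x → Pos y → Pos (x + y)
  Pos-+ (p , q) (p′ , q′) x>0 y>0 =
    subst (λ s → Pos√ s (q ⊞ q′)) (regroup (+ a) p q p′ q′)
      (Pos√-+ {+ 2 ⊠ p ⊞ q ⊠ + a} {q} {+ 2 ⊠ p′ ⊞ q′ ⊠ + a} {q′} x>0 y>0)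
    where
    regroup : ∀ A p q p′ q′ → (+ 2 ⊠ p ⊞ q ⊠ A) ⊞ (+ 2 ⊠ p′ ⊞ q′ ⊠ A) ≡ + 2 ⊠ (p ⊞ p′) ⊞ (q ⊞ q′) ⊠ A
    regroup = ℤSolver.solve-∀

  -- (2 x) (2 y) = 2 (2 x y): multiply the representatives and cancel 2.
  Pos-* : ∀ x y → Pos x → Pos y → Pos (x * y)
  Pos-* (p , q) (p′ , q′) x>0 y>0 = Pos√-cancel {+ 2} (Int.+<+ (s≤s z≤n))
    (subst₂ Pos√ (trans (cong (λ d → S ⊠ S′ ⊞ q ⊠ q′ ⊠ d) Δ≡) (first (+ a) p q p′ q′)) (second (+ a) p q p′ q′)
      (Pos√-* {S} {q} {S′} {q′} x>0 y>0))
    where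
    S S′ : ℤ
    S  = + 2 ⊠ p ⊞ q ⊠ + a
    S′ = + 2 ⊠ p′ ⊞ q′ ⊠ + a
    first : ∀ A p q p′ q′ → (+ 2 ⊠ p ⊞ q ⊠ A) ⊠ (+ 2 ⊠ p′ ⊞ q′ ⊠ A) ⊞ q ⊠ q′ ⊠ (A ⊠ A ⊞ + 4)
                           ≡ + 2 ⊠ (+ 2 ⊠ (p ⊠ p′ ⊞ q ⊠ q′) ⊞ (p ⊠ q′ ⊞ q ⊠ p′ ⊞ q ⊠ q′ ⊠ A) ⊠ A)
    first = ℤSolver.solve-∀
    second : ∀ A p q p′ q′ → (+ 2 ⊠ p ⊞ q ⊠ A) ⊠ q′ ⊞ q ⊠ (+ 2 ⊠ p′ ⊞ q′ ⊠ A) ≡ + 2 ⊠ (p ⊠ q′ ⊞ q ⊠ p′ ⊞ q ⊠ q′ ⊠ A)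
    second = ℤSolver.solve-∀

  ¬Pos-0 : ¬ Pos 0β
  ¬Pos-0 (inj₁ (0<0 , _)) = ℤP.<-irrefl refl 0<0
  ¬Pos-0 (inj₂ (0<0 , _)) = ℤP.<-irrefl refl 0<0

  NonNeg-coords : ∀ {p q} → 0ℤ Int.≤ p → 0ℤ Int.≤ q → NonNeg (p , q)
  NonNeg-coords {p} {q} 0≤p 0≤q with Pos√-coords {+ 2 ⊠ p ⊞ q ⊠ + a} {q}
    (ℤP.+-mono-≤ (*-nonneg {+ 2} {p} (Int.+≤+ z≤n) 0≤p) (*-nonneg {q} {+ a} 0≤q (Int.+≤+ z≤n))) 0≤q
  ... | inj₂ p+qβ>0 = inj₂ p+qβ>0
  ... | inj₁ (s≡0 , refl) = inj₁ (cong (_, 0ℤ) p≡0)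
    where
    p≡0 : p ≡ 0ℤ
    p≡0 with ℤP.i*j≡0⇒i≡0∨j≡0 (+ 2) (trans (sym (ℤP.+-identityʳ (+ 2 ⊠ p))) s≡0)
    ... | inj₁ ()
    ... | inj₂ p≡0 = p≡0

  Pos-+-NonNeg : ∀ x y → Pos x → NonNeg y → Pos (x + y)
  Pos-+-NonNeg x _ x>0 (inj₁ refl) = subst Pos (sym (+-zero x)) x>0
    where
    +-zero : ∀ x → x + 0β ≡ x
    +-zero = solve-∀ ring
  Pos-+-NonNeg x y x>0 (inj₂ y>0) = Pos-+ x y x>0 y>0

  NonNeg-+ : ∀ x y → NonNeg x → NonNeg y → NonNeg (x + y)
  NonNeg-+ _ y (inj₁ refl) y≥0 = subst NonNeg (sym (+-identityˡ y)) y≥0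
  NonNeg-+ x y (inj₂ x>0) y≥0 = inj₂ (Pos-+-NonNeg x y x>0 y≥0)

  NonNeg-* : ∀ x y → NonNeg x → NonNeg y → NonNeg (x * y)
  NonNeg-* _ y (inj₁ refl) _           = inj₁ (zeroˡ y)
    where
    zeroˡ : ∀ y → 0β * y ≡ 0β
    zeroˡ = solve-∀ ring
  NonNeg-* x _ (inj₂ _)   (inj₁ refl) = inj₁ (zeroʳ x)
    where
    zeroʳ : ∀ x → x * 0β ≡ 0β
    zeroʳ = solve-∀ ring
  NonNeg-* x y (inj₂ x>0) (inj₂ y>0) = inj₂ (Pos-* x y x>0 y>0)

  NonNeg⇒0≤ : ∀ {x} → NonNeg x → 0β ≤ x
  NonNeg⇒0≤ {x} x≥0 = nonneg (subst NonNeg (sym (minus-zero x)) x≥0)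
    where
    minus-zero : ∀ x → x - 0β ≡ x
    minus-zero = solve-∀ ring

  0≤⇒NonNeg : ∀ {x} → 0β ≤ x → NonNeg x
  0≤⇒NonNeg {x} (nonneg x≥0) = subst NonNeg (minus-zero x) x≥0
    where
    minus-zero : ∀ x → x - 0β ≡ x
    minus-zero = solve-∀ ring

  private
    chain : ∀ x y z → (z - y) + (y - x) ≡ z - x
    chain = solve-∀ ring

  ≤-refl : ∀ {x} → x ≤ x
  ≤-refl {x} = nonneg (inj₁ (+-inverseʳ x))

  ≤-trans : ∀ {x y z} → x ≤ y → y ≤ z → x ≤ z
  ≤-trans {x} {y} {z} (nonneg x≤y) (nonneg y≤z) =
    nonneg (subst NonNeg (chain x y z) (NonNeg-+ (z - y) (y - x) y≤z x≤y))

  ≤-<-trans : ∀ {x y z} → x ≤ y → y < z → x < z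
  ≤-<-trans {x} {y} {z} (nonneg x≤y) (pos y<z) = pos (subst Pos (chain x y z) (Pos-+-NonNeg (z - y) (y - x) y<z x≤y))

  <-irrefl : ∀ {x} → ¬ x < x
  <-irrefl {x} (pos x<x) = ¬Pos-0 (subst Pos (+-inverseʳ x) x<x)

  +-mono-≤ : ∀ {x y u v} → x ≤ y → u ≤ v → x + u ≤ y + v
  +-mono-≤ {x} {y} {u} {v} (nonneg x≤y) (nonneg u≤v) =
    nonneg (subst NonNeg (regroup x y u v) (NonNeg-+ (y - x) (v - u) x≤y u≤v))
    where
    regroup : ∀ x y u v → (y - x) + (v - u) ≡ (y + v) - (x + u)
    regroup = solve-∀ ring

  *-monoˡ-≤ : ∀ {c x y} → 0β ≤ c → x ≤ y → c * x ≤ c * y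
  *-monoˡ-≤ {c} {x} {y} 0≤c (nonneg x≤y) =
    nonneg (subst NonNeg (distrib c x y) (NonNeg-* c (y - x) (0≤⇒NonNeg 0≤c) x≤y))
    where
    distrib : ∀ c x y → c * (y - x) ≡ c * y - c * x
    distrib = solve-∀ ring

  neg-mono-≤ : ∀ {x y} → x ≤ y → - y ≤ - x
  neg-mono-≤ {x} {y} (nonneg x≤y) = nonneg (subst NonNeg (flip x y) x≤y)
    where
    flip : ∀ x y → y - x ≡ - x - - y
    flip = solve-∀ ring

  0≤1 : 0β ≤ 1β
  0≤1 = NonNeg⇒0≤ (NonNeg-coords (Int.+≤+ z≤n) ℤP.≤-refl)

  *-nonneg-≤ : ∀ {x y} → 0β ≤ x → 0β ≤ y → 0β ≤ x * y
  *-nonneg-≤ {x} {y} 0≤x 0≤y = NonNeg⇒0≤ (NonNeg-* x y (0≤⇒NonNeg 0≤x) (0≤⇒NonNeg 0≤y))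

  1≤-* : ∀ {x y} → 1β ≤ x → 1β ≤ y → 1β ≤ x * y
  1≤-* {x} {y} (nonneg 1≤x) (nonneg 1≤y) = nonneg (subst NonNeg (regroup x y)
    (NonNeg-+ (x * (y - 1β)) (x - 1β) (NonNeg-* x (y - 1β) (0≤⇒NonNeg (≤-trans 0≤1 (nonneg 1≤x))) 1≤y) 1≤x))
    where
    regroup : ∀ x y → x * (y - 1β) + (x - 1β) ≡ x * y - 1β
    regroup = solve-∀ ring

  0≤-^ : ∀ {x} n → 0β ≤ x → 0β ≤ x ^ n
  0≤-^ zero    _   = 0≤1
  0≤-^ (suc n) 0≤x = *-nonneg-≤ 0≤x (0≤-^ n 0≤x)

  1≤-^ : ∀ {x} n → 1β ≤ x → 1β ≤ x ^ n
  1≤-^ zero    _   = ≤-refl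
  1≤-^ (suc n) 1≤x = 1≤-* 1≤x (1≤-^ n 1≤x)

  ≤-*-≥1 : ∀ {c u} → 0β ≤ c → 1β ≤ u → c ≤ u * c
  ≤-*-≥1 {c} {u} 0≤c (nonneg 1≤u) = nonneg (subst NonNeg (distrib u c) (NonNeg-* (u - 1β) c 1≤u (0≤⇒NonNeg 0≤c)))
    where
    distrib : ∀ u c → (u - 1β) * c ≡ u * c - c
    distrib = solve-∀ ring

  Pos-by-norm : ∀ p q k → 0ℤ Int.< q →
                (+ 2 ⊠ p ⊞ q ⊠ + a) ⊠ (+ 2 ⊠ p ⊞ q ⊠ + a) ⊞ k ≡ q ⊠ q ⊠ (+ a ⊠ + a ⊞ + 4) →
                0ℤ Int.< k → Pos (p , q)
  Pos-by-norm p q k 0<q S²+k≡q²Δ 0<k =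
    inj₂ (0<q , subst (S ⊠ S Int.<_) (trans S²+k≡q²Δ (cong (q ⊠ q ⊠_) (sym Δ≡))) (lt (S ⊠ S) 0<k))
    where
    S : ℤ
    S = + 2 ⊠ p ⊞ q ⊠ + a
    lt : ∀ x → 0ℤ Int.< k → x Int.< x ⊞ k
    lt x 0<k = subst (Int._< x ⊞ k) (ℤP.+-identityʳ x) (ℤP.+-monoʳ-< x 0<k)

  private
    0<4a : 0ℤ Int.< + 4 ⊠ + a
    0<4a = *-pos {+ 4} {+ a} (Int.+<+ (s≤s z≤n)) (Int.+<+ 1≤a)

  0≤β : 0β ≤ β
  0≤β = NonNeg⇒0≤ (NonNeg-coords ℤP.≤-refl (Int.+≤+ z≤n))

  0≤β⁻¹ : 0β ≤ β⁻¹
  0≤β⁻¹ = NonNeg⇒0≤ (inj₂ (Pos-by-norm (Int.- + a) 1ℤ (+ 4) (Int.+<+ (s≤s z≤n))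
    (norm (+ a)) (Int.+<+ (s≤s z≤n))))
    where
    norm : ∀ A → (+ 2 ⊠ Int.- A ⊞ 1ℤ ⊠ A) ⊠ (+ 2 ⊠ Int.- A ⊞ 1ℤ ⊠ A) ⊞ + 4 ≡ 1ℤ ⊠ 1ℤ ⊠ (A ⊠ A ⊞ + 4)
    norm = ℤSolver.solve-∀

  1≤β : 1β ≤ β
  1≤β = nonneg (inj₂ (Pos-by-norm (Int.- 1ℤ) 1ℤ (+ 4 ⊠ + a) (Int.+<+ (s≤s z≤n))
    (norm (+ a)) 0<4a))
    where
    norm : ∀ A → (+ 2 ⊠ Int.- 1ℤ ⊞ 1ℤ ⊠ A) ⊠ (+ 2 ⊠ Int.- 1ℤ ⊞ 1ℤ ⊠ A) ⊞ + 4 ⊠ A ≡ 1ℤ ⊠ 1ℤ ⊠ (A ⊠ A ⊞ + 4)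
    norm = ℤSolver.solve-∀

  1≤2[β-1] : 1β ≤ ι (+ 2) * (β - 1β)
  1≤2[β-1] = nonneg (inj₂ (Pos-by-norm (Int.- + 3) (+ 2) (+ 24 ⊠ + a ⊟ + 20) (Int.+<+ (s≤s z≤n))
    (norm (+ a)) 24a>20))
    where
    norm : ∀ A → (+ 2 ⊠ Int.- + 3 ⊞ + 2 ⊠ A) ⊠ (+ 2 ⊠ Int.- + 3 ⊞ + 2 ⊠ A) ⊞ (+ 24 ⊠ A ⊟ + 20)
                 ≡ + 2 ⊠ + 2 ⊠ (A ⊠ A ⊞ + 4)
    norm = ℤSolver.solve-∀
    24a>20 : 0ℤ Int.< + 24 ⊠ + a ⊟ + 20
    24a>20 = <⇒0<- (subst (+ 20 Int.<_) (ℤP.pos-* 24 a)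
                      (Int.+<+ (ℕP.<-≤-trans {20} {24} (ℕP.m<m+n 20 (s≤s z≤n)) (ℕP.*-monoʳ-≤ 24 1≤a))))

  1≤[1+a]β⁻¹ : 1β ≤ ι (+ suc a) * β⁻¹
  1≤[1+a]β⁻¹ = nonneg (inj₂ (subst Pos (cong₂ _,_ (sym (first (+ a))) (sym (second (+ a))))
    (Pos-by-norm (Int.- ((1ℤ ⊞ + a) ⊠ + a ⊞ 1ℤ)) (1ℤ ⊞ + a) (+ 4 ⊠ + a) (Int.+<+ (s≤s z≤n))
      (norm (+ a)) 0<4a)))
    where
    first : ∀ A → (1ℤ ⊞ A) ⊠ Int.- A ⊞ 0ℤ ⊠ 1ℤ ⊞ Int.- 1ℤ ≡ Int.- ((1ℤ ⊞ A) ⊠ A ⊞ 1ℤ)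
    first = ℤSolver.solve-∀
    second : ∀ A → (1ℤ ⊞ A) ⊠ 1ℤ ⊞ 0ℤ ⊠ Int.- A ⊞ 0ℤ ⊠ 1ℤ ⊠ A ⊞ Int.- 0ℤ ≡ 1ℤ ⊞ A
    second = ℤSolver.solve-∀
    norm : ∀ A → (+ 2 ⊠ Int.- ((1ℤ ⊞ A) ⊠ A ⊞ 1ℤ) ⊞ (1ℤ ⊞ A) ⊠ A) ⊠ (+ 2 ⊠ Int.- ((1ℤ ⊞ A) ⊠ A ⊞ 1ℤ) ⊞ (1ℤ ⊞ A) ⊠ A)
                 ⊞ + 4 ⊠ A ≡ (1ℤ ⊞ A) ⊠ (1ℤ ⊞ A) ⊠ (A ⊠ A ⊞ + 4)
    norm = ℤSolver.solve-∀

  ι-mono-≤ : ∀ {m n} → m Int.≤ n → ι m ≤ ι n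
  ι-mono-≤ m≤n = nonneg (NonNeg-coords (ℤP.i≤j⇒0≤j-i m≤n) ℤP.≤-refl)

  infix 4 _≤∣_∣ ∣_∣≤_

  _≤∣_∣ ∣_∣≤_ : ℤβ → ℤβ → Set
  c ≤∣ w ∣ = c ≤ w ⊎ c ≤ - w
  ∣ w ∣≤ e = - e ≤ w × w ≤ e

  ≤∣∣-neg : ∀ {c w} → c ≤∣ w ∣ → c ≤∣ - w ∣
  ≤∣∣-neg {c} {w} (inj₁ c≤w)  = inj₂ (subst (c ≤_) (sym (neg-involutive w)) c≤w)
    where
    neg-involutive : ∀ w → - - w ≡ w
    neg-involutive = solve-∀ ring
  ≤∣∣-neg (inj₂ c≤-w) = inj₁ c≤-w

  ≤∣∣-* : ∀ {u c w} → 0β ≤ u → c ≤∣ w ∣ → u * c ≤∣ u * w ∣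
  ≤∣∣-* 0≤u (inj₁ c≤w)  = inj₁ (*-monoˡ-≤ 0≤u c≤w)
  ≤∣∣-* {u} {c} {w} 0≤u (inj₂ c≤-w) = inj₂ (subst (u * c ≤_) (*-neg u w) (*-monoˡ-≤ 0≤u c≤-w))
    where
    *-neg : ∀ u w → u * - w ≡ - (u * w)
    *-neg = solve-∀ ring

  ≤∣∣-weaken : ∀ {c′ c w} → c′ ≤ c → c ≤∣ w ∣ → c′ ≤∣ w ∣
  ≤∣∣-weaken c′≤c (inj₁ c≤w)  = inj₁ (≤-trans c′≤c c≤w)
  ≤∣∣-weaken c′≤c (inj₂ c≤-w) = inj₂ (≤-trans c′≤c c≤-w)

  ≤∣∣-+ : ∀ {c w e q} → c ≤∣ w ∣ → ∣ q ∣≤ e → c - e ≤∣ w + q ∣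
  ≤∣∣-+ (inj₁ c≤w) (-e≤q , _) = inj₁ (+-mono-≤ c≤w -e≤q)
  ≤∣∣-+ {c} {w} {e} {q} (inj₂ c≤-w) (_ , q≤e) = inj₂ (subst (c - e ≤_) (neg-+ w q) (+-mono-≤ c≤-w (neg-mono-≤ q≤e)))
    where
    neg-+ : ∀ w q → - w + - q ≡ - (w + q)
    neg-+ = solve-∀ ring

  ≤∣∣-pow : ∀ {u c w} k → 0β ≤ u → c ≤∣ w ∣ → u ^ k * c ≤∣ (- u) ^ k * w ∣
  ≤∣∣-pow {u} {c} {w} zero    _   c≤∣w∣ = subst₂ _≤∣_∣ (sym (*-identityˡ c)) (sym (*-identityˡ w)) c≤∣w∣
  ≤∣∣-pow {u} {c} {w} (suc k) 0≤u c≤∣w∣ =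
    subst₂ _≤∣_∣ (sym (*-assoc u (u ^ k) c)) (shift-sign u ((- u) ^ k) w)
      (≤∣∣-neg (≤∣∣-* 0≤u (≤∣∣-pow k 0≤u c≤∣w∣)))
    where
    shift-sign : ∀ u v w → - (u * (v * w)) ≡ (- u * v) * w
    shift-sign = solve-∀ ring

  ≤∣∣-<-contradiction : ∀ {w} → 1β ≤∣ w ∣ → w < 1β → - w < 1β → ⊥
  ≤∣∣-<-contradiction (inj₁ 1≤w)  w<1 _   = <-irrefl (≤-<-trans 1≤w w<1)
  ≤∣∣-<-contradiction (inj₂ 1≤-w) _ -w<1  = <-irrefl (≤-<-trans 1≤-w -w<1)

  LtSqrt⇒Pos√ : ∀ {c q r} → LtSqrt a c q r → Pos√ (r ⊟ c) (Int.- q)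
  LtSqrt⇒Pos√ {c} {q} {r} (when-q≥0 , when-q<0) with 0ℤ Int.≤? q
  ... | yes 0≤q = inj₁ (proj₁ (when-q≥0 0≤q) ,
                         subst (λ z → z ⊠ Δ a Int.< (r ⊟ c) ⊠ (r ⊟ c)) (sym (neg-square q)) (proj₂ (when-q≥0 0≤q)))
  ... | no q≱0 with when-q<0 (ℤP.≰⇒> q≱0)
  ...   | inj₂ s²<q²Δ = inj₂ (0<-q , subst (λ z → (r ⊟ c) ⊠ (r ⊟ c) Int.< z ⊠ Δ a) (sym (neg-square q)) s²<q²Δ)
    where
    0<-q : 0ℤ Int.< Int.- q
    0<-q = ℤP.neg-mono-< (ℤP.≰⇒> q≱0)
  ...   | inj₁ 0≤s with Pos√-coords {r ⊟ c} {Int.- q} 0≤s (ℤP.<⇒≤ (ℤP.neg-mono-< (ℤP.≰⇒> q≱0)))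
  ...     | inj₂ s-q√Δ>0   = s-q√Δ>0
  ...     | inj₁ (_ , -q≡0) = ⊥-elim (ℤP.<⇒≢ (ℤP.neg-mono-< (ℤP.≰⇒> q≱0)) (sym -q≡0))

  Small⇒<1 : ∀ N w → Small a N w → ι (+ suc N) * w < 1β × - (ι (+ suc N) * w) < 1β
  Small⇒<1 N (p , q) (upper , lower) =
    pos (subst₂ Pos√ (first-upper (+ a) k p q) (second-upper (+ a) k p q) (LtSqrt⇒Pos√ {c} {k ⊠ q} {+ 2} upper)) ,
    pos (subst₂ Pos√ (first-lower (+ a) k p q) (second-lower (+ a) k p q)
          (LtSqrt⇒Pos√ {Int.- c} {Int.- (k ⊠ q)} {+ 2} lower))
    where
    k c : ℤ
    k = + suc N
    c = + 2 ⊠ (k ⊠ p) ⊞ k ⊠ q ⊠ + a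
    first-upper : ∀ A k p q → + 2 ⊟ (+ 2 ⊠ (k ⊠ p) ⊞ k ⊠ q ⊠ A)
                  ≡ + 2 ⊠ (1ℤ ⊞ Int.- (k ⊠ p ⊞ 0ℤ ⊠ q)) ⊞ (0ℤ ⊞ Int.- (k ⊠ q ⊞ 0ℤ ⊠ p ⊞ 0ℤ ⊠ q ⊠ A)) ⊠ A
    first-upper = ℤSolver.solve-∀
    second-upper : ∀ A k p q → Int.- (k ⊠ q) ≡ 0ℤ ⊞ Int.- (k ⊠ q ⊞ 0ℤ ⊠ p ⊞ 0ℤ ⊠ q ⊠ A)
    second-upper = ℤSolver.solve-∀
    first-lower : ∀ A k p q → + 2 ⊟ Int.- (+ 2 ⊠ (k ⊠ p) ⊞ k ⊠ q ⊠ A)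
                  ≡ + 2 ⊠ (1ℤ ⊞ Int.- (Int.- (k ⊠ p ⊞ 0ℤ ⊠ q))) ⊞ (0ℤ ⊞ Int.- (Int.- (k ⊠ q ⊞ 0ℤ ⊠ p ⊞ 0ℤ ⊠ q ⊠ A))) ⊠ A
    first-lower = ℤSolver.solve-∀
    second-lower : ∀ A k p q → Int.- (Int.- (k ⊠ q)) ≡ 0ℤ ⊞ Int.- (Int.- (k ⊠ q ⊞ 0ℤ ⊠ p ⊞ 0ℤ ⊠ q ⊠ A))
    second-lower = ℤSolver.solve-∀

  -- Digits, carries and escapes

  Bounded : (ℕ → ℕ) → Set
  Bounded X = ∀ j → X j Nat.≤ a

  pad-bounded : ∀ δ f → Bounded f → Bounded (pad δ f)
  pad-bounded zero    f f≤a j       = f≤a j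
  pad-bounded (suc δ) f f≤a zero    = z≤n
  pad-bounded (suc δ) f f≤a (suc j) = pad-bounded δ f f≤a j

  α α⁻¹ : ℤβ
  α   = - β⁻¹
  α⁻¹ = - β

  α*α⁻¹≡1 : α * α⁻¹ ≡ 1β
  α*α⁻¹≡1 = trans (neg-*-neg β⁻¹ β) β*β⁻¹≡1
    where
    neg-*-neg : ∀ u v → - u * - v ≡ v * u
    neg-*-neg = solve-∀ ring

  β-a≡β⁻¹ : β - ι (+ a) ≡ β⁻¹
  β-a≡β⁻¹ = cong₂ _,_ (ℤP.+-identityˡ (Int.- + a)) refl

  -- value X n = Σ_{j<n} X j α^(j - n)
  value : (ℕ → ℕ) → ℕ → ℤβ
  value X zero    = 0β
  value X (suc n) = α⁻¹ * (value X n + ι (+ X n))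

  -- block X n δ = Σ_{i<δ} X (n + i) α^i
  block : (ℕ → ℕ) → ℕ → ℕ → ℤβ
  block X n zero    = 0β
  block X n (suc δ) = ι (+ X n) + α * block X (suc n) δ

  carry : (ℕ → ℕ) → (ℕ → ℕ) → ℕ → ℤβ
  carry X Y n = value X n - value Y n

  carry-suc : ∀ X Y n → carry X Y (suc n) ≡ α⁻¹ * (carry X Y n + (ι (+ X n) - ι (+ Y n)))
  carry-suc X Y n = factor α⁻¹ (value X n) (value Y n) (ι (+ X n)) (ι (+ Y n))
    where
    factor : ∀ u v w x y → u * (v + x) - u * (w + y) ≡ u * ((v - w) + (x - y))
    factor = solve-∀ ring

  digit-bounds : ∀ {x} → x Nat.≤ a → 0β ≤ ι (+ x) × ι (+ x) ≤ ι (+ a)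
  digit-bounds x≤a = ι-mono-≤ (Int.+≤+ z≤n) , ι-mono-≤ (Int.+≤+ x≤a)

  digit-difference-bounds : ∀ {x y} → x Nat.≤ a → y Nat.≤ a → ∣ ι (+ x) - ι (+ y) ∣≤ ι (+ a)
  digit-difference-bounds {x} {y} x≤a y≤a =
    ι-mono-≤ (ℤP.≤-trans (ℤP.neg-mono-≤ (Int.+≤+ y≤a)) (ℤP.i≤j+i (Int.- + y) (+ x))) ,
    ι-mono-≤ (ℤP.≤-trans (ℤP.i-j≤i (+ x) (+ y)) (Int.+≤+ x≤a))

  block-bounds : ∀ {X} → Bounded X → ∀ δ n → - 1β ≤ block X n δ × block X n δ ≤ β
  block-bounds X≤a zero    n = neg-mono-≤ 0≤1 , 0≤β
  block-bounds {X} X≤a (suc δ) n =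
    subst₂ _≤_ (+-identityˡ (- 1β)) refl (+-mono-≤ 0≤x -1≤αP) ,
    subst₂ _≤_ refl a+β⁻¹≡β (+-mono-≤ x≤a αP≤β⁻¹)
    where
    P : ℤβ
    P = block X (suc n) δ
    0≤x : 0β ≤ ι (+ X n)
    0≤x = proj₁ (digit-bounds (X≤a n))
    x≤a : ι (+ X n) ≤ ι (+ a)
    x≤a = proj₂ (digit-bounds (X≤a n))
    neg-* : ∀ u p → - (u * p) ≡ - u * p
    neg-* = solve-∀ ring
    -1≤αP : - 1β ≤ α * P
    -1≤αP = subst₂ _≤_ (cong -_ β⁻¹*β≡1) (neg-* β⁻¹ P)
              (neg-mono-≤ (*-monoˡ-≤ 0≤β⁻¹ (proj₂ (block-bounds X≤a δ (suc n)))))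
    αP≤β⁻¹ : α * P ≤ β⁻¹
    αP≤β⁻¹ = subst₂ _≤_ (neg-* β⁻¹ P) (neg-neg-one β⁻¹)
              (neg-mono-≤ (*-monoˡ-≤ 0≤β⁻¹ (proj₁ (block-bounds X≤a δ (suc n)))))
      where
      neg-neg-one : ∀ u → - (u * - 1β) ≡ u
      neg-neg-one = solve-∀ ring
    a+β⁻¹≡β : ι (+ a) + β⁻¹ ≡ β
    a+β⁻¹≡β = trans (cong (_+_ (ι (+ a))) (sym β-a≡β⁻¹)) (cancel (ι (+ a)) β)
      where
      cancel : ∀ x y → x + (y - x) ≡ y
      cancel = solve-∀ ring

  Escaped : ℤβ → Set
  Escaped w = ι (+ 2) * β ≤∣ w ∣

  escape-bound : ℕ → ℤβ
  escape-bound j = 1β + β + β ^ j * (β - 1β)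

  escape-bound-suc : ∀ j → β * (escape-bound j - ι (+ a)) ≡ escape-bound (suc j)
  escape-bound-suc j = begin
    β * (escape-bound j - ι (+ a))                            ≡⟨ expand β (ι (+ a)) (β ^ j) ⟩
    β * (β - ι (+ a)) + β + β * β ^ j * (β - 1β)   ≡⟨ cong (λ z → β * z + β + β ^ suc j * (β - 1β)) β-a≡β⁻¹ ⟩
    β * β⁻¹ + β + β ^ suc j * (β - 1β)             ≡⟨ cong (λ z → z + β + β ^ suc j * (β - 1β)) β*β⁻¹≡1 ⟩
    escape-bound (suc j)                                      ∎
    where
    open ≡-Reasoning
    expand : ∀ b A P → b * (1β + b + P * (b - 1β) - A) ≡ b * (b - A) + b + b * P * (b - 1β)
    expand = solve-∀ ring

  escape-step : ∀ {c t d} → c ≤∣ t ∣ → ∣ d ∣≤ ι (+ a) → β * (c - ι (+ a)) ≤∣ α⁻¹ * (t + d) ∣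
  escape-step {c} {t} {d} c≤∣t∣ ∣d∣≤a =
    subst (β * (c - ι (+ a)) ≤∣_∣) (neg-* β (t + d)) (≤∣∣-neg (≤∣∣-* 0≤β (≤∣∣-+ c≤∣t∣ ∣d∣≤a)))
    where
    neg-* : ∀ b x → - (b * x) ≡ - b * x
    neg-* = solve-∀ ring

  escape-grows : ∀ {X Y m} → Bounded X → Bounded Y → Escaped (carry X Y m) → ∀ j → escape-bound j ≤∣ carry X Y (j Nat.+ m) ∣
  escape-grows {X} {Y} {m} X≤a Y≤a esc zero = subst (_≤∣ carry X Y m ∣) (E₀ β) esc
    where
    E₀ : ∀ b → ι (+ 2) * b ≡ 1β + b + 1β * (b - 1β)
    E₀ = solve-∀ ring
  escape-grows {X} {Y} {m} X≤a Y≤a esc (suc j) =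
    subst₂ _≤∣_∣ (escape-bound-suc j) (sym (carry-suc X Y (j Nat.+ m)))
      (escape-step (escape-grows X≤a Y≤a esc j) (digit-difference-bounds (X≤a (j Nat.+ m)) (Y≤a (j Nat.+ m))))

  value-pad-suc : ∀ δ f k → value (pad (suc δ) f) (suc k) ≡ value (pad δ f) k
  value-pad-suc δ f zero    = refl
  value-pad-suc δ f (suc k) = cong (λ v → α⁻¹ * (v + ι (+ pad δ f k))) (value-pad-suc δ f k)

  value-pad : ∀ δ f n → value (pad δ f) (δ Nat.+ n) ≡ value f n
  value-pad zero    f n = refl
  value-pad (suc δ) f n = trans (value-pad-suc δ f (δ Nat.+ n)) (value-pad δ f n)

  value-block : ∀ X δ n → α ^ δ * value X (δ Nat.+ n) ≡ value X n + block X n δ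
  value-block X zero    n = plus-zero (value X n)
    where
    plus-zero : ∀ v → 1β * v ≡ v + 0β
    plus-zero = solve-∀ ring
  value-block X (suc δ) n = begin
    α * α ^ δ * value X (suc (δ Nat.+ n))          ≡⟨ cong (λ k → α * α ^ δ * value X k) (sym (ℕP.+-suc δ n)) ⟩
    α * α ^ δ * value X (δ Nat.+ suc n)            ≡⟨ *-assoc α (α ^ δ) (value X (δ Nat.+ suc n)) ⟩
    α * (α ^ δ * value X (δ Nat.+ suc n))          ≡⟨ cong (α *_) (value-block X δ (suc n)) ⟩
    α * (α⁻¹ * (value X n + x) + B)                ≡⟨ regroup α α⁻¹ (value X n) x B ⟩
    α * α⁻¹ * (value X n + x) + α * B              ≡⟨ cong (λ z → z * (value X n + x) + α * B) α*α⁻¹≡1 ⟩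
    1β * (value X n + x) + α * B                   ≡⟨ unit (value X n) x (α * B) ⟩
    value X n + block X n (suc δ)                  ∎
    where
    open ≡-Reasoning
    x B : ℤβ
    x = ι (+ X n)
    B = block X (suc n) δ
    regroup : ∀ u u′ v x b → u * (u′ * (v + x) + b) ≡ u * u′ * (v + x) + u * b
    regroup = solve-∀ ring
    unit : ∀ v x y → 1β * (v + x) + y ≡ v + (x + y)
    unit = solve-∀ ring

  partialSum-suc : ∀ (x : Expansion a) n →
                   partialSum x (suc n) ≡ partialSum x n + ι (+ digit x n) * (α ^ n * α⁻¹ ^ shift x)
  partialSum-suc x n = cong (_+_ (partialSum x n)) (trans (mulβ≡* (ι (+ digit x n)) _)
    (cong (ι (+ digit x n) *_) (trans (mulβ≡* (powβ a (αβ a) n) (powβ a (α⁻¹β a) (shift x)))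
      (cong₂ _*_ (trans (powβ≡^ (αβ a) n) (cong (_^ n) α≡-β⁻¹)) (powβ≡^ (α⁻¹β a) (shift x))))))

  partialSum-value : ∀ (x : Expansion a) n → partialSum x n ≡ α⁻¹ ^ shift x * (α ^ n * value (digit x) n)
  partialSum-value x zero    = sym (vanish (α⁻¹ ^ shift x))
    where
    vanish : ∀ L → L * (1β * 0β) ≡ 0β
    vanish = solve-∀ ring
  partialSum-value x (suc n) = begin
    partialSum x (suc n)                   ≡⟨ partialSum-suc x n ⟩
    partialSum x n + d * (α ^ n * L)       ≡⟨ cong (_+ d * (α ^ n * L)) (partialSum-value x n) ⟩
    L * (α ^ n * v) + d * (α ^ n * L)      ≡⟨ sym (*-identityˡ (L * (α ^ n * v) + d * (α ^ n * L))) ⟩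
    1β * (L * (α ^ n * v) + d * (α ^ n * L)) ≡⟨ cong (_* (L * (α ^ n * v) + d * (α ^ n * L))) (sym α*α⁻¹≡1) ⟩
    α * α⁻¹ * (L * (α ^ n * v) + d * (α ^ n * L))
                                           ≡⟨ sym (regroup L (α ^ n) α α⁻¹ v d) ⟩
    L * (α ^ suc n * value (digit x) (suc n)) ∎
    where
    open ≡-Reasoning
    d L v : ℤβ
    d = ι (+ digit x n)
    L = α⁻¹ ^ shift x
    v = value (digit x) n
    regroup : ∀ L P u u′ v x → L * (u * P * (u′ * (v + x))) ≡ u * u′ * (L * (P * v) + x * (P * L))
    regroup = solve-∀ ring

  partialSum-aligned : ∀ (x : Expansion a) δ n →
    partialSum x n ≡ α⁻¹ ^ (shift x Nat.+ δ) * (α ^ n * (value (pad δ (digit x)) n + block (pad δ (digit x)) n δ))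
  partialSum-aligned x δ n = begin
    partialSum x n                                        ≡⟨ partialSum-value x n ⟩
    L * (α ^ n * value (digit x) n)                       ≡⟨ cong (λ v → L * (α ^ n * v)) (sym (value-pad δ (digit x) n)) ⟩
    L * (α ^ n * v)                                       ≡⟨ sym (*-identityˡ (L * (α ^ n * v))) ⟩
    1β * (L * (α ^ n * v))                                ≡⟨ cong (_* (L * (α ^ n * v))) (sym (inverse-powers α⁻¹*α≡1 δ)) ⟩
    α⁻¹ ^ δ * α ^ δ * (L * (α ^ n * v))                   ≡⟨ regroup L (α⁻¹ ^ δ) (α ^ δ) (α ^ n) v ⟩
    L * α⁻¹ ^ δ * (α ^ n * (α ^ δ * v))                   ≡⟨ cong₂ (λ u w → u * (α ^ n * w)) (sym (^-+ α⁻¹ (shift x) δ))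
                                                                                          (value-block X δ n) ⟩
    α⁻¹ ^ (shift x Nat.+ δ) * (α ^ n * (value X n + block X n δ)) ∎
    where
    open ≡-Reasoning
    X : ℕ → ℕ
    X = pad δ (digit x)
    L v : ℤβ
    L = α⁻¹ ^ shift x
    v = value X (δ Nat.+ n)
    α⁻¹*α≡1 : α⁻¹ * α ≡ 1β
    α⁻¹*α≡1 = trans (*-comm α⁻¹ α) α*α⁻¹≡1
    regroup : ∀ L u u′ P v → u * u′ * (L * (P * v)) ≡ L * u * (P * (u′ * v))
    regroup = solve-∀ ring

  escape-threshold : ℕ → ℤβ
  escape-threshold m = β⁻¹ ^ m * (β - 1β)

  0≤escape-threshold : ∀ m → 0β ≤ escape-threshold m
  0≤escape-threshold m = *-nonneg-≤ (0≤-^ m 0≤β⁻¹) (NonNeg⇒0≤ (_≤_.nonNegative 1≤β))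

  1≤[1+N]escape-threshold : ∀ m → 1β ≤ ι (+ suc (2 Nat.* suc a Nat.^ m)) * escape-threshold m
  1≤[1+N]escape-threshold m =
    subst₂ _≤_ (+-identityˡ 1β) (sym (distrib (ι (+ N)) c)) (+-mono-≤ (0≤escape-threshold m) 1≤Nc)
    where
    N : ℕ
    N = 2 Nat.* suc a Nat.^ m
    c : ℤβ
    c = escape-threshold m
    distrib : ∀ n c → (1β + n) * c ≡ c + n * c
    distrib = solve-∀ ring
    regroup : ∀ t s u v → t * s * (u * v) ≡ t * v * (s * u)
    regroup = solve-∀ ring
    1≤Nc : 1β ≤ ι (+ N) * c
    1≤Nc = subst (1β ≤_) (sym Nc≡) (1≤-* 1≤2[β-1] (1≤-^ m 1≤[1+a]β⁻¹))
      where
      Nc≡ : ι (+ N) * c ≡ ι (+ 2) * (β - 1β) * (ι (+ suc a) * β⁻¹) ^ m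
      Nc≡ = begin
        ι (+ N) * c                                      ≡⟨ cong (_* c) (trans (cong ι (ℤP.pos-* 2 (suc a Nat.^ m)))
                                                                              (ι-* (+ 2) (+ (suc a Nat.^ m)))) ⟩
        ι (+ 2) * ι (+ (suc a Nat.^ m)) * c              ≡⟨ cong (λ z → ι (+ 2) * z * c) (ι-^ (suc a) m) ⟩
        ι (+ 2) * ι (+ suc a) ^ m * (β⁻¹ ^ m * (β - 1β)) ≡⟨ regroup (ι (+ 2)) (ι (+ suc a) ^ m) (β⁻¹ ^ m) (β - 1β) ⟩
        ι (+ 2) * (β - 1β) * (ι (+ suc a) ^ m * β⁻¹ ^ m) ≡⟨ cong (ι (+ 2) * (β - 1β) *_) (sym (*-^ (ι (+ suc a)) β⁻¹ m)) ⟩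
        ι (+ 2) * (β - 1β) * (ι (+ suc a) * β⁻¹) ^ m     ∎
        where open ≡-Reasoning

  NoEscape : (ℕ → ℕ) → (ℕ → ℕ) → Set
  NoEscape X Y = ∀ n → ¬ Escaped (carry X Y n)

  -- Both expansions are rewritten with the common shift  shift x + shift y.
  module Aligned (x y : Expansion a) where

    X Y : ℕ → ℕ
    X = pad (shift y) (digit x)
    Y = pad (shift x) (digit y)

    difference : ∀ n → partialSum x n ⊖ partialSum y n
                 ≡ α⁻¹ ^ (shift x Nat.+ shift y) * (α ^ n * (carry X Y n + (block X n (shift y) - block Y n (shift x))))
    difference n = begin
      partialSum x n - partialSum y n
        ≡⟨ cong₂ _-_ (partialSum-aligned x (shift y) n)
                     (trans (partialSum-aligned y (shift x) n)
                            (cong (λ k → α⁻¹ ^ k * (α ^ n * (value Y n + block Y n (shift x)))) (ℕP.+-comm (shift y) (shift x)))) ⟩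
      L * (α ^ n * (value X n + block X n (shift y))) - L * (α ^ n * (value Y n + block Y n (shift x)))
        ≡⟨ factor L (α ^ n) (value X n) (value Y n) (block X n (shift y)) (block Y n (shift x)) ⟩
      L * (α ^ n * (carry X Y n + (block X n (shift y) - block Y n (shift x)))) ∎
      where
      open ≡-Reasoning
      L : ℤβ
      L = α⁻¹ ^ (shift x Nat.+ shift y)
      factor : ∀ L P u v b c → L * (P * (u + b)) - L * (P * (v + c)) ≡ L * (P * ((u - v) + (b - c)))
      factor = solve-∀ ring

    X≤a : Bounded X
    X≤a = pad-bounded (shift y) (digit x) (digit-bound x)

    Y≤a : Bounded Y
    Y≤a = pad-bounded (shift x) (digit y) (digit-bound y)

    block-difference-bounds : ∀ n → ∣ block X n (shift y) - block Y n (shift x) ∣≤ 1β + β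
    block-difference-bounds n =
      subst₂ _≤_ (neg-+ 1β β) refl (+-mono-≤ (proj₁ BX) (neg-mono-≤ (proj₂ BY))) ,
      subst₂ _≤_ refl (plus-neg-neg β 1β) (+-mono-≤ (proj₂ BX) (neg-mono-≤ (proj₁ BY)))
      where
      BX : - 1β ≤ block X n (shift y) × block X n (shift y) ≤ β
      BX = block-bounds X≤a (shift y) n
      BY : - 1β ≤ block Y n (shift x) × block Y n (shift x) ≤ β
      BY = block-bounds Y≤a (shift x) n
      neg-+ : ∀ u v → - u + - v ≡ - (u + v)
      neg-+ = solve-∀ ring
      plus-neg-neg : ∀ u v → u + - - v ≡ v + u
      plus-neg-neg = solve-∀ ring

    escaped⇒difference-large : ∀ m → Escaped (carry X Y m) →
                               ∀ M → escape-threshold m ≤∣ partialSum x (M Nat.+ m) ⊖ partialSum y (M Nat.+ m) ∣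
    escaped⇒difference-large m esc M =
      ≤∣∣-weaken (≤-*-≥1 (0≤escape-threshold m) (1≤-^ K 1≤β))
        (subst₂ _≤∣_∣ (cong (β ^ K *_) coefficient) (sym (difference (M Nat.+ m)))
          (≤∣∣-pow K 0≤β (≤∣∣-pow (M Nat.+ m) 0≤β⁻¹
            (≤∣∣-+ (escape-grows X≤a Y≤a esc M) (block-difference-bounds (M Nat.+ m))))))
      where
      K : ℕ
      K = shift x Nat.+ shift y
      coefficient : β⁻¹ ^ (M Nat.+ m) * (escape-bound M - (1β + β)) ≡ escape-threshold m
      coefficient = begin
        β⁻¹ ^ (M Nat.+ m) * (escape-bound M - (1β + β)) ≡⟨ cong₂ _*_ (^-+ β⁻¹ M m) (drop (β ^ M) β) ⟩
        β⁻¹ ^ M * β⁻¹ ^ m * (β ^ M * (β - 1β))          ≡⟨ regroup (β⁻¹ ^ M) (β⁻¹ ^ m) (β ^ M) (β - 1β) ⟩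
        β⁻¹ ^ M * β ^ M * escape-threshold m            ≡⟨ cong (_* escape-threshold m) (inverse-powers β⁻¹*β≡1 M) ⟩
        1β * escape-threshold m                         ≡⟨ *-identityˡ (escape-threshold m) ⟩
        escape-threshold m                              ∎
        where
        open ≡-Reasoning
        drop : ∀ P b → 1β + b + P * (b - 1β) - (1β + b) ≡ P * (b - 1β)
        drop = solve-∀ ring
        regroup : ∀ u v w z → u * v * (w * z) ≡ u * w * (v * z)
        regroup = solve-∀ ring

    -- The threshold after an escape at m exceeds 1/(N+1) for N = 2 (1 + a)^m.
    no-escape : SameValue x y → NoEscape X Y
    no-escape same m esc = ≤∣∣-<-contradiction
      (≤∣∣-weaken (1≤[1+N]escape-threshold m) (≤∣∣-* {k} (ι-mono-≤ (Int.+≤+ z≤n)) (escaped⇒difference-large m esc M)))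
      (proj₁ small) (proj₂ small)
      where
      N : ℕ
      N = 2 Nat.* suc a Nat.^ m
      k D : ℤβ
      k = ι (+ suc N)
      M : ℕ
      M = proj₁ (same N)
      D = partialSum x (M Nat.+ m) ⊖ partialSum y (M Nat.+ m)
      small : ι (+ suc N) * D < 1β × - (ι (+ suc N) * D) < 1β
      small = Small⇒<1 N D (proj₂ (same N) (M Nat.+ m) (ℕP.m≤m+n M m))

  -- The carry automaton

  Admissible : (ℕ → ℕ) → Set
  Admissible X = ∀ j → X (suc j) Nat.< a ⊎ (X (suc j) ≡ a × X j Nat.< 1)

  Admissible⇒< : ∀ {X j} → Admissible X → 1 Nat.≤ X j → X (suc j) Nat.< a
  Admissible⇒< {X} {j} adm 1≤Xj with adm j
  ... | inj₁ X[1+j]<a      = X[1+j]<a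
  ... | inj₂ (_ , Xj<1)    = ⊥-elim (ℕP.<⇒≱ Xj<1 1≤Xj)

  pad-admissible : ∀ δ f → Bounded f → Admissible f → Admissible (pad δ f)
  pad-admissible zero    f _   adm = adm
  pad-admissible (suc δ) f f≤a adm zero with ℕP.m≤n⇒m<n∨m≡n (pad-bounded δ f f≤a zero)
  ... | inj₁ <a = inj₁ <a
  ... | inj₂ ≡a = inj₂ (≡a , s≤s z≤n)
  pad-admissible (suc δ) f f≤a adm (suc j) = pad-admissible δ f f≤a adm j

  1+β : ℤβ
  1+β = 1β + β

  private
    2≤B-C : ∀ {B C} → 2 Nat.+ C Nat.≤ B → + 2 Int.≤ + B ⊟ + C
    2≤B-C {B} {C} 2+C≤B = subst (+ 2 Int.≤_) (pos-∸ (ℕP.m+n≤o⇒n≤o 2 2+C≤B)) (Int.+≤+ (ℕP.m+n≤o⇒m≤o∸n 2 2+C≤B))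

  escaped-up : ∀ {u B C} → 0ℤ Int.≤ u → 2 Nat.+ C Nat.≤ B → Escaped (u , + B ⊟ + C)
  escaped-up {u} 0≤u 2+C≤B =
    inj₁ (nonneg (NonNeg-coords (subst (0ℤ Int.≤_) (sym (ℤP.+-identityʳ u)) 0≤u) (ℤP.i≤j⇒0≤j-i (2≤B-C 2+C≤B))))

  escaped-down : ∀ {u B C} → u Int.≤ 0ℤ → 2 Nat.+ B Nat.≤ C → Escaped (u , + B ⊟ + C)
  escaped-down {u} {B} {C} u≤0 2+B≤C =
    inj₂ (nonneg (NonNeg-coords (subst (0ℤ Int.≤_) (sym (ℤP.+-identityʳ (Int.- u))) (ℤP.neg-mono-≤ u≤0))
                                (ℤP.i≤j⇒0≤j-i (subst (+ 2 Int.≤_) (neg-minus (+ B) (+ C)) (2≤B-C 2+B≤C)))))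
    where
    neg-minus : ∀ b c → c ⊟ b ≡ Int.- (b ⊟ c)
    neg-minus = ℤSolver.solve-∀

  carry-next : ∀ X Y n {t₁ t₂} → carry X Y n ≡ (t₁ , t₂) →
               carry X Y (suc n) ≡ (Int.- t₂ , + Y n ⊟ + X n ⊟ (t₁ ⊞ t₂ ⊠ + a))
  carry-next X Y n {t₁} {t₂} eq = trans (carry-suc X Y n) (trans (cong (λ t → α⁻¹ * (t + (ι (+ X n) - ι (+ Y n)))) eq)
    (cong₂ _,_ (first t₁ t₂ (+ X n) (+ Y n)) (second (+ a) t₁ t₂ (+ X n) (+ Y n))))
    where
    first : ∀ t₁ t₂ x y → 0ℤ ⊠ (t₁ ⊞ (x ⊞ Int.- y)) ⊞ Int.- 1ℤ ⊠ (t₂ ⊞ (0ℤ ⊞ Int.- 0ℤ)) ≡ Int.- t₂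
    first = ℤSolver.solve-∀
    second : ∀ A t₁ t₂ x y → 0ℤ ⊠ (t₂ ⊞ (0ℤ ⊞ Int.- 0ℤ)) ⊞ Int.- 1ℤ ⊠ (t₁ ⊞ (x ⊞ Int.- y))
                              ⊞ Int.- 1ℤ ⊠ (t₂ ⊞ (0ℤ ⊞ Int.- 0ℤ)) ⊠ A ≡ y ⊟ x ⊟ (t₁ ⊞ t₂ ⊠ A)
    second = ℤSolver.solve-∀

  module Automaton {X Y : ℕ → ℕ} (X≤a : Bounded X) (Y≤a : Bounded Y)
                   (X-adm : Admissible X) (Y-adm : Admissible Y) (no-escape : NoEscape X Y) where

    private
      not-escaped : ∀ n {w} → carry X Y n ≡ w → ¬ Escaped w
      not-escaped n eq esc = no-escape n (subst Escaped (sym eq) esc)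

      succ-minus : ∀ x → (1ℤ ⊞ x) ⊟ x ≡ 1ℤ
      succ-minus = ℤSolver.solve-∀

      minus-succ : ∀ x → x ⊟ (1ℤ ⊞ x) ≡ Int.- 1ℤ
      minus-succ = ℤSolver.solve-∀

    Step-from-0 : ℕ → Set
    Step-from-0 n = (X n ≡ Y n × carry X Y (suc n) ≡ 0β)
                  ⊎ (X n ≡ suc (Y n) × carry X Y (suc n) ≡ - β)
                  ⊎ (Y n ≡ suc (X n) × carry X Y (suc n) ≡ β)

    from-0 : ∀ n → carry X Y n ≡ 0β → Step-from-0 n
    from-0 n eq = classify (near-or-far (X n) (Y n))
      where
      next : carry X Y (suc n) ≡ (0ℤ , + Y n ⊟ + X n)
      next = trans (carry-next X Y n eq) (cong (0ℤ ,_) (ℤP.+-identityʳ (+ Y n ⊟ + X n)))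
      next≡ : ∀ {v} → + Y n ⊟ + X n ≡ v → carry X Y (suc n) ≡ (0ℤ , v)
      next≡ v≡ = trans next (cong (0ℤ ,_) v≡)
      classify : NearOrFar (X n) (Y n) → Step-from-0 n
      classify (inj₁ x≡y) =
        inj₁ (x≡y , next≡ (trans (cong (λ z → + Y n ⊟ + z) x≡y) (ℤP.+-inverseʳ (+ Y n))))
      classify (inj₂ (inj₁ y≡1+x)) =
        inj₂ (inj₂ (y≡1+x , next≡ (trans (cong (λ z → + z ⊟ + X n) y≡1+x) (succ-minus (+ X n)))))
      classify (inj₂ (inj₂ (inj₁ x≡1+y))) =
        inj₂ (inj₁ (x≡1+y , next≡ (trans (cong (λ z → + Y n ⊟ + z) x≡1+y) (minus-succ (+ Y n)))))
      classify (inj₂ (inj₂ (inj₂ (inj₁ 2+x≤y)))) = ⊥-elim (not-escaped (suc n) next (escaped-up ℤP.≤-refl 2+x≤y))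
      classify (inj₂ (inj₂ (inj₂ (inj₂ 2+y≤x)))) = ⊥-elim (not-escaped (suc n) next (escaped-down ℤP.≤-refl 2+y≤x))

    from--β : ∀ n → carry X Y n ≡ - β → X n Nat.< a → (Y n ≡ 0 × suc (X n) ≡ a) × carry X Y (suc n) ≡ 1+β
    from--β n eq Xn<a = squeezed , trans next (cong (1ℤ ,_) (trans
      (cong₂ (λ y z → + (y Nat.+ z) ⊟ + X n) (proj₁ squeezed) (sym (proj₂ squeezed))) (succ-minus (+ X n))))
      where
      shape : ∀ A x y → y ⊟ x ⊟ (0ℤ ⊞ Int.- 1ℤ ⊠ A) ≡ (y ⊞ A) ⊟ x
      shape = ℤSolver.solve-∀
      next : carry X Y (suc n) ≡ (1ℤ , + (Y n Nat.+ a) ⊟ + X n)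
      next = trans (carry-next X Y n eq) (cong (1ℤ ,_) (shape (+ a) (+ X n) (+ Y n)))
      squeezed : Y n ≡ 0 × suc (X n) ≡ a
      squeezed = squeeze 1 Xn<a (λ 2+x≤y+a → not-escaped (suc n) next (escaped-up (Int.+≤+ z≤n) 2+x≤y+a))

    from-β : ∀ n → carry X Y n ≡ β → Y n Nat.< a → (X n ≡ 0 × suc (Y n) ≡ a) × carry X Y (suc n) ≡ - 1+β
    from-β n eq Yn<a = squeezed , trans next (cong (Int.- 1ℤ ,_) (trans
      (cong₂ (λ x z → + Y n ⊟ + (x Nat.+ z)) (proj₁ squeezed) (sym (proj₂ squeezed))) (minus-succ (+ Y n))))
      where
      shape : ∀ A x y → y ⊟ x ⊟ (0ℤ ⊞ 1ℤ ⊠ A) ≡ y ⊟ (x ⊞ A)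
      shape = ℤSolver.solve-∀
      next : carry X Y (suc n) ≡ (Int.- 1ℤ , + Y n ⊟ + (X n Nat.+ a))
      next = trans (carry-next X Y n eq) (cong (Int.- 1ℤ ,_) (shape (+ a) (+ X n) (+ Y n)))
      squeezed : X n ≡ 0 × suc (Y n) ≡ a
      squeezed = squeeze 1 Yn<a (λ 2+y≤x+a → not-escaped (suc n) next (escaped-down Int.-≤+ 2+y≤x+a))

    from-1+β : ∀ n → carry X Y n ≡ 1+β → (X n ≡ 0 × Y n ≡ a) × carry X Y (suc n) ≡ - 1+β
    from-1+β n eq = squeezed , trans next (cong (Int.- 1ℤ ,_) (trans
      (cong₂ (λ x y → + y ⊟ + (x Nat.+ suc a)) (proj₁ squeezed) (proj₂ squeezed)) (minus-succ (+ a))))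
      where
      shape : ∀ A x y → y ⊟ x ⊟ (1ℤ ⊞ 1ℤ ⊠ A) ≡ y ⊟ (x ⊞ (1ℤ ⊞ A))
      shape = ℤSolver.solve-∀
      next : carry X Y (suc n) ≡ (Int.- 1ℤ , + Y n ⊟ + (X n Nat.+ suc a))
      next = trans (carry-next X Y n eq) (cong (Int.- 1ℤ ,_) (shape (+ a) (+ X n) (+ Y n)))
      squeezed : X n ≡ 0 × Y n ≡ a
      squeezed = squeeze 0 (Y≤a n) (λ 1+y≤x+a → not-escaped (suc n) next
                   (escaped-down Int.-≤+ (subst (2 Nat.+ Y n Nat.≤_) (sym (ℕP.+-suc (X n) a)) (s≤s 1+y≤x+a))))

    from--1+β : ∀ n → carry X Y n ≡ - 1+β → (Y n ≡ 0 × X n ≡ a) × carry X Y (suc n) ≡ 1+β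
    from--1+β n eq = squeezed , trans next (cong (1ℤ ,_) (trans
      (cong₂ (λ y x → + (y Nat.+ suc a) ⊟ + x) (proj₁ squeezed) (proj₂ squeezed)) (succ-minus (+ a))))
      where
      shape : ∀ A x y → y ⊟ x ⊟ (Int.- 1ℤ ⊞ Int.- 1ℤ ⊠ A) ≡ (y ⊞ (1ℤ ⊞ A)) ⊟ x
      shape = ℤSolver.solve-∀
      next : carry X Y (suc n) ≡ (1ℤ , + (Y n Nat.+ suc a) ⊟ + X n)
      next = trans (carry-next X Y n eq) (cong (1ℤ ,_) (shape (+ a) (+ X n) (+ Y n)))
      squeezed : Y n ≡ 0 × X n ≡ a
      squeezed = squeeze 0 (X≤a n) (λ 1+x≤y+a → not-escaped (suc n) next
                   (escaped-up (Int.+≤+ z≤n) (subst (2 Nat.+ X n Nat.≤_) (sym (ℕP.+-suc (Y n) a)) (s≤s 1+x≤y+a))))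

    InCycle : ℕ → Set
    InCycle n = carry X Y n ≡ 1+β ⊎ carry X Y n ≡ - 1+β

    data Reachable : ℕ → Set where
      balanced : ∀ {n} → carry X Y n ≡ 0β → Reachable n
      X-ahead  : ∀ {n} → carry X Y (suc n) ≡ - β → X n ≡ suc (Y n) → Reachable (suc n)
      Y-ahead  : ∀ {n} → carry X Y (suc n) ≡ β → Y n ≡ suc (X n) → Reachable (suc n)
      cycling  : ∀ {n} → InCycle n → Reachable n

    InCycle-suc : ∀ n → InCycle n → InCycle (suc n)
    InCycle-suc n (inj₁ eq) = inj₂ (proj₂ (from-1+β n eq))
    InCycle-suc n (inj₂ eq) = inj₁ (proj₂ (from--1+β n eq))

    InCycle-from : ∀ m → InCycle m → ∀ i → m Nat.≤ i → InCycle i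
    InCycle-from m c i m≤i = subst InCycle (proj₂ (ℕP.m≤n⇒∃[o]m+o≡n m≤i)) (go (proj₁ (ℕP.m≤n⇒∃[o]m+o≡n m≤i)))
      where
      go : ∀ k → InCycle (m Nat.+ k)
      go zero    = subst InCycle (sym (ℕP.+-identityʳ m)) c
      go (suc k) = subst InCycle (sym (ℕP.+-suc m k)) (InCycle-suc (m Nat.+ k) (go k))

    after-X-ahead : ∀ n → carry X Y (suc n) ≡ - β → X n ≡ suc (Y n) →
                    (Y (suc n) ≡ 0 × suc (X (suc n)) ≡ a) × carry X Y (suc (suc n)) ≡ 1+β
    after-X-ahead n eq x≡1+y = from--β (suc n) eq (Admissible⇒< X-adm (subst (1 Nat.≤_) (sym x≡1+y) (s≤s z≤n)))

    after-Y-ahead : ∀ n → carry X Y (suc n) ≡ β → Y n ≡ suc (X n) →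
                    (X (suc n) ≡ 0 × suc (Y (suc n)) ≡ a) × carry X Y (suc (suc n)) ≡ - 1+β
    after-Y-ahead n eq y≡1+x = from-β (suc n) eq (Admissible⇒< Y-adm (subst (1 Nat.≤_) (sym y≡1+x) (s≤s z≤n)))

    Reachable-suc : ∀ {n} → Reachable n → Reachable (suc n)
    Reachable-suc {n} (balanced eq) with from-0 n eq
    ... | inj₁ (_ , eq′)               = balanced eq′
    ... | inj₂ (inj₁ (x≡1+y , eq′))    = X-ahead eq′ x≡1+y
    ... | inj₂ (inj₂ (y≡1+x , eq′))    = Y-ahead eq′ y≡1+x
    Reachable-suc (X-ahead {n} eq x≡1+y) = cycling (inj₁ (proj₂ (after-X-ahead n eq x≡1+y)))
    Reachable-suc (Y-ahead {n} eq y≡1+x) = cycling (inj₂ (proj₂ (after-Y-ahead n eq y≡1+x)))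
    Reachable-suc {n} (cycling c)        = cycling (InCycle-suc n c)

    reachable : ∀ n → Reachable n
    reachable zero    = balanced refl
    reachable (suc n) = Reachable-suc (reachable n)

    unbalanced⇒InCycle : ∀ {n} → Reachable n → carry X Y n ≢ 0β → InCycle (suc n)
    unbalanced⇒InCycle (balanced eq)            ≢0 = ⊥-elim (≢0 eq)
    unbalanced⇒InCycle (X-ahead {n} eq x≡1+y) _  = inj₁ (proj₂ (after-X-ahead n eq x≡1+y))
    unbalanced⇒InCycle (Y-ahead {n} eq y≡1+x) _  = inj₂ (proj₂ (after-Y-ahead n eq y≡1+x))
    unbalanced⇒InCycle {n} (cycling c)        _  = InCycle-suc n c

    -- In the cycle the digits alternate:  X = 0, Y = a  at 1 + β  and  X = a, Y = 0  at -(1 + β).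
    InCycle⇒Y-2-periodic : ∀ n → InCycle n → Y (suc (suc n)) ≡ Y n
    InCycle⇒Y-2-periodic n (inj₁ eq) =
      trans (proj₂ (proj₁ (from-1+β (suc (suc n)) eq₂))) (sym (proj₂ (proj₁ (from-1+β n eq))))
      where
      eq₂ : carry X Y (suc (suc n)) ≡ 1+β
      eq₂ = proj₂ (from--1+β (suc n) (proj₂ (from-1+β n eq)))
    InCycle⇒Y-2-periodic n (inj₂ eq) =
      trans (proj₁ (proj₁ (from--1+β (suc (suc n)) eq₂))) (sym (proj₁ (proj₁ (from--1+β n eq))))
      where
      eq₂ : carry X Y (suc (suc n)) ≡ - 1+β
      eq₂ = proj₂ (from-1+β (suc n) (proj₂ (from--1+β n eq)))

    InCycle⇒X-sum : ∀ n → InCycle n → X n Nat.+ X (suc n) ≡ a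
    InCycle⇒X-sum n (inj₁ eq) = cong₂ Nat._+_ (proj₁ (proj₁ (from-1+β n eq))) (proj₂ (proj₁ (from--1+β (suc n) eq₁)))
      where
      eq₁ : carry X Y (suc n) ≡ - 1+β
      eq₁ = proj₂ (from-1+β n eq)
    InCycle⇒X-sum n (inj₂ eq) =
      trans (cong₂ Nat._+_ (proj₂ (proj₁ (from--1+β n eq))) (proj₁ (proj₁ (from-1+β (suc n) eq₁)))) (ℕP.+-identityʳ a)
      where
      eq₁ : carry X Y (suc n) ≡ 1+β
      eq₁ = proj₂ (from--1+β n eq)

    -- If the carry is 0 at a point N after which X is periodic, it stays 0: leaving 0 would
    -- start the cycle, where X alternates between 0 and a, and by periodicity X would
    -- alternate from N on, which the digits at the exit contradict.
    module PeriodicFrom {p N} (1≤p : 1 Nat.≤ p) (X-per : ∀ i → N Nat.≤ i → X (i Nat.+ p) ≡ X i) where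

      X-alternates : ∀ m → InCycle m → ∀ j → N Nat.≤ j → X j Nat.+ X (suc j) ≡ a
      X-alternates m c = consecutive-pull-back (λ u v → u Nat.+ v ≡ a) 1≤p X-per
                           (λ j m≤j → InCycle⇒X-sum j (InCycle-from m c j m≤j))

      stays-balanced : ∀ i → N Nat.≤ i → carry X Y i ≡ 0β → X i ≡ Y i × carry X Y (suc i) ≡ 0β
      stays-balanced i N≤i eq with from-0 i eq
      ... | inj₁ r = r
      ... | inj₂ (inj₁ (x≡1+y , eq′)) = ⊥-elim (ℕP.1+n≢n (trans (proj₂ (proj₁ after)) (sym x≡a)))
        where
        after : (Y (suc i) ≡ 0 × suc (X (suc i)) ≡ a) × carry X Y (suc (suc i)) ≡ 1+β
        after = after-X-ahead i eq′ x≡1+y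
        x≡a : X (suc i) ≡ a
        x≡a = trans (sym (ℕP.+-identityʳ (X (suc i))))
                (trans (cong (X (suc i) Nat.+_) (sym (proj₁ (proj₁ (from-1+β (suc (suc i)) (proj₂ after))))))
                  (X-alternates (suc (suc i)) (inj₁ (proj₂ after)) (suc i) (ℕP.m≤n⇒m≤1+n N≤i)))
      ... | inj₂ (inj₂ (y≡1+x , eq′)) = ⊥-elim (ℕP.1+n≰n (subst (Nat._≤ a) (trans y≡1+x (cong suc x≡a)) (Y≤a i)))
        where
        after : (X (suc i) ≡ 0 × suc (Y (suc i)) ≡ a) × carry X Y (suc (suc i)) ≡ - 1+β
        after = after-Y-ahead i eq′ y≡1+x
        x≡a : X i ≡ a
        x≡a = trans (sym (ℕP.+-identityʳ (X i)))
                (trans (cong (X i Nat.+_) (sym (proj₁ (proj₁ after))))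
                  (X-alternates (suc (suc i)) (inj₂ (proj₂ after)) i N≤i))

      balanced-from : carry X Y N ≡ 0β → ∀ k → carry X Y (N Nat.+ k) ≡ 0β
      balanced-from eq zero    = subst (λ i → carry X Y i ≡ 0β) (sym (ℕP.+-identityʳ N)) eq
      balanced-from eq (suc k) = subst (λ i → carry X Y i ≡ 0β) (sym (ℕP.+-suc N k))
                                   (proj₂ (stays-balanced (N Nat.+ k) (ℕP.m≤m+n N k) (balanced-from eq k)))

      X≡Y-from : carry X Y N ≡ 0β → ∀ i → N Nat.≤ i → X i ≡ Y i
      X≡Y-from eq i N≤i with ℕP.m≤n⇒∃[o]m+o≡n N≤i
      ... | k , refl = proj₁ (stays-balanced (N Nat.+ k) N≤i (balanced-from eq k))

    Y-eventually-periodic : EventuallyPeriodicSeq X → EventuallyPeriodicSeq Y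
    Y-eventually-periodic (p , 1≤p , N , X-per) with ≡-dec ℤP._≟_ ℤP._≟_ (carry X Y N) 0β
    ... | no ≢0 = 2 , s≤s z≤n , suc N , λ i 1+N≤i → trans (cong Y (ℕP.+-comm i 2))
            (InCycle⇒Y-2-periodic i (InCycle-from (suc N) (unbalanced⇒InCycle (reachable N) ≢0) i 1+N≤i))
    ... | yes ≡0 = p , 1≤p , N , λ i N≤i →
            trans (sym (X≡Y (i Nat.+ p) (ℕP.≤-trans N≤i (ℕP.m≤m+n i p)))) (trans (X-per i N≤i) (X≡Y i N≤i))
      where
      X≡Y : ∀ i → N Nat.≤ i → X i ≡ Y i
      X≡Y = PeriodicFrom.X≡Y-from 1≤p X-per ≡0

mainTheorem7 : (a : ℕ) → 1 Nat.≤ a → (x y : Expansion a) →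
    WeaklyAdmissible x → WeaklyAdmissible y →
    EventuallyPeriodic x → SameValue x y → EventuallyPeriodic y
mainTheorem7 a 1≤a x y x-adm y-adm x-per same =
  unpad-periodic (shift x) (digit y) (Y-eventually-periodic (pad-periodic (shift y) (digit x) x-per))
  where
  open QuadraticPisot a 1≤a
  open Aligned x y
  open Automaton X≤a Y≤a (pad-admissible (shift y) (digit x) (digit-bound x) x-adm)
                         (pad-admissible (shift x) (digit y) (digit-bound y) y-adm) (no-escape same)
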